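{- Let $M\in\{M_1,\ldots,M_{13}\}$ and let $h$ be a positive integer such that $\sigma(M^{2h})$ factors in $\mathcal{F}$. Then either ($M=M_1$ and $2h\in\{2,4,6,14\}$) or ($M\in\{M_2,M_3\}$ and $2h=2$). Moreover, $\sigma(M_2^2)=M_1M_5$, $\sigma(M_3^2)=M_1M_4$, $\sigma(M_1^2)=S_1$, $\sigma(M_1^4)=S_8$, $\sigma(M_1^6)=M_2M_3S_2$, $\sigma(M_1^{14})=M_4M_5S_1S_7S_8$.
   Context: $\sigma(A)$ is the sum of all monic divisors of $A\in\mathbb{F}_2[x]$. A polynomial "factors in" $\mathcal{F}$ if it is a product of (possibly repeated) members of $\mathcal{F}$. For $Q\in\mathbb{F}_2[x]$, $\overline{Q}(x)=Q(x+1)$. $\mathcal{F}=\{M_1,\ldots,M_{13},S_1,\ldots,S_{15}\}$ where $M_1=1+x+x^2$, $M_2=1+x+x^3$, $M_3=1+x^2+x^3$, $M_4=1+x+x^2+x^3+x^4$, $M_5=1+x^3+x^4$, $M_6=1+x^3+x^5$, $M_7=1+x^3+x^7$, $M_8=1+x^6+x^7$, $M_9=\overline{M_6}$, $M_{10}=\overline{M_7}$, $M_{11}=\overline{M_8}$, $M_{12}=1+x+x^9$, $M_{13}=1+x^8+x^9$, $S_1=1+x(x+1)M_1$, $S_2=1+x^2(x+1)^2M_1$, $S_3=1+x(x+1)^3M_1^4$, $S_4=1+x^3(x+1)M_1$, $S_5=1+x(x+1)^3M_1$, $S_6=1+x^3(x+1)M_1^4$, $S_7=1+x(x+1)M_1^3$,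 $S_8=1+x^3(x+1)^3M_1$, $S_9=1+x(x+1)M_1^5$, $S_{10}=1+x^4(x+1)M_1$, $S_{11}=1+x(x+1)^2M_1$, $S_{12}=1+x^2(x+1)M_1^2$, $S_{13}=1+x(x+1)^4M_1$, $S_{14}=1+x^2(x+1)M_1$, $S_{15}=1+x(x+1)^2M_1^2$. -}

module Defs where

open import Data.Bool using (Bool; true; false; _xor_; _∧_; not; if_then_else_)
open import Data.Nat using (ℕ; zero; suc)
open import Data.List using (List; []; _∷_; length; filter; concatMap; foldr)
open import Data.Bool.ListAction using (any)
open import Data.Bool using (T?)
open import Data.List.Relation.Unary.All using (All)
open import Data.List.Membership.Propositional using (_∈_)
open import Data.Fin using (Fin)
open import Data.Product using (∃; _×_)
open import Data.Vec using (Vec; lookup) renaming ([] to []ᵥ; _∷_ to _∷ᵥ_)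
open import Relation.Binary.PropositionalEquality using (_≡_)

-- Polynomials over F₂: coefficient lists, lowest degree first.
-- [a₀, a₁, …, aₙ] represents a₀ + a₁ x + … + aₙ xⁿ.
-- A list may carry trailing zero coefficients; `norm` removes them,
-- and polynomial equality `_≈_` compares normal forms.

Poly : Set
Poly = List Bool

norm : Poly → Poly
norm [] = []
norm (c ∷ p) with norm p
... | [] = if c then true ∷ [] else []
... | q ∷ qs = c ∷ q ∷ qs

_≈_ : Poly → Poly → Set
p ≈ q = norm p ≡ norm q

infix 4 _≈_

eqB : Bool → Bool → Bool
eqB a b = not (a xor b)

eqL : List Bool → List Bool → Bool
eqL [] [] = true
eqL [] (_ ∷ _) = false
eqL (_ ∷ _) [] = false
eqL (a ∷ p) (b ∷ q) = eqB a b ∧ eqL p q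

_==_ : Poly → Poly → Bool
p == q = eqL (norm p) (norm q)

isZero : Poly → Bool
isZero p = norm p == []

infixl 6 _+ₚ_
_+ₚ_ : Poly → Poly → Poly
[] +ₚ q = q
(a ∷ p) +ₚ [] = a ∷ p
(a ∷ p) +ₚ (b ∷ q) = (a xor b) ∷ (p +ₚ q)

scale : Bool → Poly → Poly
scale true p = p
scale false p = []

infixl 7 _*ₚ_
_*ₚ_ : Poly → Poly → Poly
[] *ₚ q = []
(a ∷ p) *ₚ q = scale a q +ₚ (false ∷ (p *ₚ q))

oneₚ : Poly
oneₚ = true ∷ []

X : Poly
X = false ∷ true ∷ []

infixr 8 _^ₚ_
_^ₚ_ : Poly → ℕ → Poly
p ^ₚ zero = oneₚ
p ^ₚ suc n = p *ₚ (p ^ₚ n)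

prod : List Poly → Poly
prod = foldr _*ₚ_ oneₚ

sumₚ : List Poly → Poly
sumₚ = foldr _+ₚ_ []

-- Q̄(x) = Q(x+1), by Horner's scheme
bar : Poly → Poly
bar [] = []
bar (c ∷ q) = (c ∷ []) +ₚ ((true ∷ true ∷ []) *ₚ bar q)

-- all coefficient lists of length exactly n
-- (= all polynomials of degree < n, each exactly once)
lists : ℕ → List Poly
lists zero = [] ∷ []
lists (suc n) = concatMap (λ p → (false ∷ p) ∷ (true ∷ p) ∷ []) (lists n)

-- the number of coefficients of A (deg A + 1 for A ≠ 0)
size : Poly → ℕ
size A = length (norm A)

-- Boolean divisibility test: D ∣ A iff A = D·Q for some Q;
-- for A ≠ 0 such a Q has degree ≤ deg A, so we search those.
dividesB : Poly → Poly → Bool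
dividesB D A = any (λ Q → (D *ₚ Q) == A) (lists (size A))

-- the monic divisors of A (over F₂ every nonzero polynomial is monic;
-- each divisor of A ≠ 0 has degree ≤ deg A, so it is among `lists (size A)`)
monicDivisors : Poly → List Poly
monicDivisors A =
  filter (λ D → T? (not (isZero D) ∧ dividesB D A))
         (lists (size A))

σ : Poly → Poly
σ A = sumₚ (monicDivisors A)

M₁ M₂ M₃ M₄ M₅ M₆ M₇ M₈ M₉ M₁₀ M₁₁ M₁₂ M₁₃ : Poly
M₁  = true ∷ true ∷ true ∷ []                                   -- 1+x+x²
M₂  = true ∷ true ∷ false ∷ true ∷ []                           -- 1+x+x³
M₃  = true ∷ false ∷ true ∷ true ∷ []                           -- 1+x²+x³
M₄  = true ∷ true ∷ true ∷ true ∷ true ∷ []                     -- 1+x+x²+x³+x⁴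
M₅  = true ∷ false ∷ false ∷ true ∷ true ∷ []                   -- 1+x³+x⁴
M₆  = true ∷ false ∷ false ∷ true ∷ false ∷ true ∷ []           -- 1+x³+x⁵
M₇  = true ∷ false ∷ false ∷ true ∷ false ∷ false ∷ false ∷ true ∷ []  -- 1+x³+x⁷
M₈  = true ∷ false ∷ false ∷ false ∷ false ∷ false ∷ true ∷ true ∷ []  -- 1+x⁶+x⁷
M₉  = bar M₆
M₁₀ = bar M₇
M₁₁ = bar M₈
M₁₂ = true ∷ true ∷ false ∷ false ∷ false ∷ false ∷ false ∷ false ∷ false ∷ true ∷ []  -- 1+x+x⁹
M₁₃ = true ∷ false ∷ false ∷ false ∷ false ∷ false ∷ false ∷ false ∷ true ∷ true ∷ []  -- 1+x⁸+x⁹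

-- M i = M_{i+1}
Ms : Vec Poly 13
Ms = M₁ ∷ᵥ M₂ ∷ᵥ M₃ ∷ᵥ M₄ ∷ᵥ M₅ ∷ᵥ M₆ ∷ᵥ M₇ ∷ᵥ M₈ ∷ᵥ M₉ ∷ᵥ M₁₀ ∷ᵥ M₁₁ ∷ᵥ M₁₂ ∷ᵥ M₁₃ ∷ᵥ []ᵥ

M : Fin 13 → Poly
M i = lookup Ms i

X1 : Poly
X1 = true ∷ true ∷ []

S[_,_,_] : ℕ → ℕ → ℕ → Poly
S[ a , b , c ] = oneₚ +ₚ (X ^ₚ a) *ₚ (X1 ^ₚ b) *ₚ (M₁ ^ₚ c)

S₁ S₂ S₃ S₄ S₅ S₆ S₇ S₈ S₉ S₁₀ S₁₁ S₁₂ S₁₃ S₁₄ S₁₅ : Poly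
S₁  = S[ 1 , 1 , 1 ]
S₂  = S[ 2 , 2 , 1 ]
S₃  = S[ 1 , 3 , 4 ]
S₄  = S[ 3 , 1 , 1 ]
S₅  = S[ 1 , 3 , 1 ]
S₆  = S[ 3 , 1 , 4 ]
S₇  = S[ 1 , 1 , 3 ]
S₈  = S[ 3 , 3 , 1 ]
S₉  = S[ 1 , 1 , 5 ]
S₁₀ = S[ 4 , 1 , 1 ]
S₁₁ = S[ 1 , 2 , 1 ]
S₁₂ = S[ 2 , 1 , 2 ]
S₁₃ = S[ 1 , 4 , 1 ]
S₁₄ = S[ 2 , 1 , 1 ]
S₁₅ = S[ 1 , 2 , 2 ]

𝓕 : List Poly
𝓕 = M₁ ∷ M₂ ∷ M₃ ∷ M₄ ∷ M₅ ∷ M₆ ∷ M₇ ∷ M₈ ∷ M₉ ∷ M₁₀ ∷ M₁₁ ∷ M₁₂ ∷ M₁₃ ∷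
    S₁ ∷ S₂ ∷ S₃ ∷ S₄ ∷ S₅ ∷ S₆ ∷ S₇ ∷ S₈ ∷ S₉ ∷ S₁₀ ∷ S₁₁ ∷ S₁₂ ∷ S₁₃ ∷ S₁₄ ∷ S₁₅ ∷ []

FactorsIn𝓕 : Poly → Set
FactorsIn𝓕 A = ∃ λ (fs : List Poly) → All (_∈ 𝓕) fs × prod fs ≈ A

-- Each M = Mᵢ is irreducible: modulo M every nonzero residue v has the inverse v^(2ᵈ−2), d = deg M,
-- as is checked by computation. Hence the divisors of M²ʰ are the powers Mʲ, and σ(M²ʰ) = 1 + M + ⋯ + M²ʰ.
-- Since σ(M²ʰ)·(M + 1) = M²ʰ⁺¹ + 1 has derivative M²ʰ·M′, a repeated factor f of σ(M²ʰ) divides M′;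
-- no member of 𝓕 divides M′, so a factorization over 𝓕 uses distinct members, each dividing σ(M²ʰ).
-- Comparing degrees, 2h·deg M is at most the total degree of the members of 𝓕 dividing σ(M²ʰ), and
-- in particular at most the total degree 184 of 𝓕. This bounds h, and the finitely many remaining h
-- are settled by computing remainders.

module Submission where

open import Defs
open import Algebra.Bundles using (CommutativeMonoid; CommutativeSemigroup)
import Algebra.Properties.CommutativeSemigroup as CommSemigroupProps
open import Data.Bool using (Bool; true; false; _xor_; _∧_; not; T; T?; if_then_else_)
open import Data.Bool.ListAction using (any)
open import Data.Bool.Properties
  using (xor-assoc; xor-comm; xor-identityʳ; xor-same; ∧-distribʳ-xor; T-∧) renaming (_≟_ to _≟ᵇ_)
open import Data.Empty using (⊥-elim)
open import Data.Fin using (Fin; zero; suc; toℕ)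
import Data.Fin.Properties as Fin
open import Data.Fin.Subset.Properties using (anySubset?)
open import Data.List using (List; []; _∷_; _++_; length; replicate; map; concatMap; downFrom; filter)
open import Data.List.Properties using (length-++; length-replicate; ≡-dec)
open import Data.List.Membership.Propositional using (_∈_; find; lose)
open import Data.List.Membership.DecPropositional (≡-dec _≟ᵇ_) using (_∈?_)
open import Data.List.Membership.Propositional.Properties
  using (∈-concatMap⁺; ∈-concatMap⁻; ∈-filter⁺; ∈-filter⁻; ∈-map⁺; ∈-map⁻; ∈-downFrom⁺; ∈-downFrom⁻;
         ∈-∃++; ∈-++⁻; ∈-++⁺ˡ; ∈-++⁺ʳ)
open import Data.List.Membership.Propositional.Properties.WithK using (unique∧set⇒bag)
open import Data.List.Relation.Binary.BagAndSetEquality using (∼bag⇒↭)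
open import Data.List.Relation.Binary.Permutation.Propositional using (_↭_; ↭⇒↭ₛ′)
open import Data.List.Relation.Binary.Permutation.Setoid.Properties using (foldr-commMonoid)
open import Data.List.Relation.Unary.All using (All; []; _∷_)
import Data.List.Relation.Unary.All as All
import Data.List.Relation.Unary.AllPairs as AllPairs
open import Data.List.Relation.Unary.Any using (here; there)
import Data.List.Relation.Unary.Any as Any
open import Data.List.Relation.Unary.Any.Properties using (any⁺; any⁻)
open import Data.List.Relation.Unary.Unique.Propositional using (Unique)
open import Data.List.Relation.Unary.Unique.Propositional.Properties using (filter⁺; map⁺; downFrom⁺)
open import Data.Nat using (ℕ; zero; suc; pred; _+_; _*_; _∸_; _≤_; _<_; z≤n; s≤s)
open import Data.Nat.DivMod using (_/_)
open import Data.Nat.ListAction using (sum)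
open import Data.Nat.Properties
  using (_≟_; _<?_; <-cmp; ≤-refl; ≤-trans; ≤-pred; n≤1+n; m≤n+m; ≮⇒≥; ≤⇒≯; <⇒≱; m∸n≤m; m+[n∸m]≡n;
         m+n≡0⇒m≡0; suc-injective; +-comm; +-assoc; +-identityʳ; +-cancelˡ-≡; +-monoʳ-≤; *-monoˡ-≤;
         *-monoʳ-≤; *-cancelʳ-≡; +-commutativeSemigroup; allUpTo?; module ≤-Reasoning)
open import Data.Product using (∃; _×_; _,_; proj₁; proj₂; map₁)
open import Data.Sum using (_⊎_; inj₁; inj₂; [_,_]′)
open import Data.Vec using (Vec; toList; zipWith; tabulate)
  renaming ([] to []ᵥ; _∷_ to _∷ᵥ_; replicate to replicateᵥ)
open import Data.Vec.Properties using (length-toList; toList-replicate) renaming (≡-dec to ≡-decᵥ)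
open import Function using (id; _∘_; _⇔_; mk⇔; Equivalence)
open import Relation.Binary.Bundles using (Setoid)
open import Relation.Binary.Definitions using (tri<; tri≈; tri>)
open import Relation.Binary.PropositionalEquality
import Relation.Binary.Reasoning.Setoid as SetoidReasoning
open import Relation.Nullary using (¬_; Dec; yes; no; ¬?)
open import Relation.Nullary.Decidable using (True; toWitness; _×-dec_; _⊎-dec_; map′; decidable-stable)
open import Relation.Unary using (Decidable)

-- Coefficientwise equality and the ring laws of F₂[x]

coeff : Poly → ℕ → Bool
coeff [] n = false
coeff (c ∷ p) zero = c
coeff (c ∷ p) (suc n) = coeff p n

infix 4 _≐_
record _≐_ (p q : Poly) : Set where
  constructor mk≐
  field coeff-≡ : ∀ n → coeff p n ≡ coeff q n
open _≐_ public

≐-refl : ∀ {p} → p ≐ p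
≐-refl = mk≐ λ _ → refl

≐-reflexive : ∀ {p q} → p ≡ q → p ≐ q
≐-reflexive refl = ≐-refl

≐-sym : ∀ {p q} → p ≐ q → q ≐ p
≐-sym e = mk≐ λ n → sym (coeff-≡ e n)

≐-trans : ∀ {p q r} → p ≐ q → q ≐ r → p ≐ r
≐-trans e f = mk≐ λ n → trans (coeff-≡ e n) (coeff-≡ f n)

≐-setoid : Setoid _ _
≐-setoid = record
  { Carrier = Poly ; _≈_ = _≐_
  ; isEquivalence = record { refl = ≐-refl ; sym = ≐-sym ; trans = ≐-trans } }

module ≐-Reasoning = SetoidReasoning ≐-setoid

replicate-false≐[] : ∀ k → replicate k false ≐ []
replicate-false≐[] zero = ≐-refl
replicate-false≐[] (suc k) = mk≐ λ { zero → refl ; (suc n) → coeff-≡ (replicate-false≐[] k) n }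

∷-cong : ∀ c {p q} → p ≐ q → c ∷ p ≐ c ∷ q
∷-cong c e = mk≐ λ { zero → refl ; (suc n) → coeff-≡ e n }

∷-injectiveʳ : ∀ {a b p q} → a ∷ p ≐ b ∷ q → p ≐ q
∷-injectiveʳ e = mk≐ λ n → coeff-≡ e (suc n)

∷≐[]⇒≐[] : ∀ {a p} → a ∷ p ≐ [] → p ≐ []
∷≐[]⇒≐[] e = mk≐ λ n → coeff-≡ e (suc n)

[]≐false∷[] : [] ≐ false ∷ []
[]≐false∷[] = mk≐ λ { zero → refl ; (suc n) → refl }

coeff-+ₚ : ∀ p q n → coeff (p +ₚ q) n ≡ coeff p n xor coeff q n
coeff-+ₚ [] q n = refl
coeff-+ₚ (a ∷ p) [] n = sym (xor-identityʳ _)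
coeff-+ₚ (a ∷ p) (b ∷ q) zero = refl
coeff-+ₚ (a ∷ p) (b ∷ q) (suc n) = coeff-+ₚ p q n

∷-+ₚ : ∀ c p q → c ∷ (p +ₚ q) ≡ (c ∷ p) +ₚ (false ∷ q)
∷-+ₚ c p q = cong (_∷ (p +ₚ q)) (sym (xor-identityʳ c))

coeff-scale : ∀ a p n → coeff (scale a p) n ≡ a ∧ coeff p n
coeff-scale true p n = refl
coeff-scale false p n = refl

+ₚ-cong : ∀ {p p′ q q′} → p ≐ p′ → q ≐ q′ → p +ₚ q ≐ p′ +ₚ q′
+ₚ-cong {p} {p′} {q} {q′} e f = mk≐ λ n → begin
  coeff (p +ₚ q) n             ≡⟨ coeff-+ₚ p q n ⟩
  coeff p n xor coeff q n      ≡⟨ cong₂ _xor_ (coeff-≡ e n) (coeff-≡ f n) ⟩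
  coeff p′ n xor coeff q′ n    ≡⟨ coeff-+ₚ p′ q′ n ⟨
  coeff (p′ +ₚ q′) n           ∎
  where open ≡-Reasoning

+ₚ-congˡ : ∀ p {q q′} → q ≐ q′ → p +ₚ q ≐ p +ₚ q′
+ₚ-congˡ p = +ₚ-cong (≐-refl {p})

+ₚ-congʳ : ∀ r {p p′} → p ≐ p′ → p +ₚ r ≐ p′ +ₚ r
+ₚ-congʳ r e = +ₚ-cong e (≐-refl {r})

+ₚ-comm : ∀ p q → p +ₚ q ≡ q +ₚ p
+ₚ-comm [] [] = refl
+ₚ-comm [] (b ∷ q) = refl
+ₚ-comm (a ∷ p) [] = refl
+ₚ-comm (a ∷ p) (b ∷ q) = cong₂ _∷_ (xor-comm a b) (+ₚ-comm p q)

+ₚ-assoc : ∀ p q r → (p +ₚ q) +ₚ r ≡ p +ₚ (q +ₚ r)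
+ₚ-assoc [] q r = refl
+ₚ-assoc (a ∷ p) [] r = refl
+ₚ-assoc (a ∷ p) (b ∷ q) [] = refl
+ₚ-assoc (a ∷ p) (b ∷ q) (c ∷ r) = cong₂ _∷_ (xor-assoc a b c) (+ₚ-assoc p q r)

+ₚ-identityʳ : ∀ p → p +ₚ [] ≡ p
+ₚ-identityʳ [] = refl
+ₚ-identityʳ (a ∷ p) = refl

+ₚ-self : ∀ p → p +ₚ p ≐ []
+ₚ-self p = mk≐ λ n → trans (coeff-+ₚ p p n) (xor-same (coeff p n))

+ₚ-commutativeMonoid : CommutativeMonoid _ _
+ₚ-commutativeMonoid = record
  { Carrier = Poly ; _≈_ = _≐_ ; _∙_ = _+ₚ_ ; ε = []
  ; isCommutativeMonoid = record
    { isMonoid = record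
      { isSemigroup = record
        { isMagma = record { isEquivalence = Setoid.isEquivalence ≐-setoid ; ∙-cong = +ₚ-cong }
        ; assoc = λ p q r → ≐-reflexive (+ₚ-assoc p q r) }
      ; identity = (λ _ → ≐-refl) , λ p → ≐-reflexive (+ₚ-identityʳ p) }
    ; comm = λ p q → ≐-reflexive (+ₚ-comm p q) } }

module +ₚ-Props = CommSemigroupProps (CommutativeMonoid.commutativeSemigroup +ₚ-commutativeMonoid)

+ₚ-self-cancelˡ : ∀ p q → p +ₚ (p +ₚ q) ≐ q
+ₚ-self-cancelˡ p q = ≐-trans (≐-reflexive (sym (+ₚ-assoc p p q))) (+ₚ-congʳ q (+ₚ-self p))

+ₚ-cancel-middle : ∀ p q r → (p +ₚ q) +ₚ (q +ₚ r) ≐ p +ₚ r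
+ₚ-cancel-middle p q r = ≐-trans (≐-reflexive (+ₚ-assoc p q (q +ₚ r))) (+ₚ-congˡ p (+ₚ-self-cancelˡ q r))

+ₚ-transpose : ∀ p q r s → p +ₚ q ≐ r +ₚ s → p +ₚ r ≐ q +ₚ s
+ₚ-transpose p q r s e = begin
  p +ₚ r                ≈⟨ +ₚ-cancel-middle p q r ⟨
  (p +ₚ q) +ₚ (q +ₚ r)  ≈⟨ +ₚ-cong e (≐-reflexive (+ₚ-comm q r)) ⟩
  (r +ₚ s) +ₚ (r +ₚ q)  ≡⟨ cong (_+ₚ (r +ₚ q)) (+ₚ-comm r s) ⟩
  (s +ₚ r) +ₚ (r +ₚ q)  ≈⟨ +ₚ-cancel-middle s r q ⟩
  s +ₚ q                ≡⟨ +ₚ-comm s q ⟩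
  q +ₚ s                ∎
  where open ≐-Reasoning

+ₚ≐[]⇒≐ : ∀ {p q} → p +ₚ q ≐ [] → p ≐ q
+ₚ≐[]⇒≐ {p} {q} e = ≐-sym (begin
  q                ≈⟨ +ₚ-self-cancelˡ p q ⟨
  p +ₚ (p +ₚ q)    ≈⟨ +ₚ-congˡ p e ⟩
  p +ₚ []          ≡⟨ +ₚ-identityʳ p ⟩
  p                ∎)
  where open ≐-Reasoning

scale-cong : ∀ a {p q} → p ≐ q → scale a p ≐ scale a q
scale-cong true e = e
scale-cong false e = ≐-refl

scale-xor : ∀ a b p → scale (a xor b) p ≐ scale a p +ₚ scale b p
scale-xor a b p = mk≐ λ n → begin
  coeff (scale (a xor b) p) n                  ≡⟨ coeff-scale (a xor b) p n ⟩
  (a xor b) ∧ coeff p n                        ≡⟨ ∧-distribʳ-xor (coeff p n) a b ⟩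
  (a ∧ coeff p n) xor (b ∧ coeff p n)          ≡⟨ cong₂ _xor_ (coeff-scale a p n) (coeff-scale b p n) ⟨
  coeff (scale a p) n xor coeff (scale b p) n  ≡⟨ coeff-+ₚ (scale a p) (scale b p) n ⟨
  coeff (scale a p +ₚ scale b p) n             ∎
  where open ≡-Reasoning

scale-+ₚ : ∀ a p q → scale a (p +ₚ q) ≡ scale a p +ₚ scale a q
scale-+ₚ true p q = refl
scale-+ₚ false p q = refl

scale-*ₚ : ∀ a p q → scale a p *ₚ q ≡ scale a (p *ₚ q)
scale-*ₚ true p q = refl
scale-*ₚ false p q = refl

*ₚ-zeroˡ : ∀ {p} q → p ≐ [] → p *ₚ q ≐ []
*ₚ-zeroˡ {[]} q e = ≐-refl
*ₚ-zeroˡ {a ∷ p} q e with coeff-≡ e zero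
... | refl = ≐-trans (∷-cong false (*ₚ-zeroˡ q (∷≐[]⇒≐[] e))) (≐-sym []≐false∷[])

*ₚ-congʳ : ∀ {p p′} q → p ≐ p′ → p *ₚ q ≐ p′ *ₚ q
*ₚ-congʳ {[]} q e = ≐-sym (*ₚ-zeroˡ q (≐-sym e))
*ₚ-congʳ {a ∷ p} {[]} q e = *ₚ-zeroˡ q e
*ₚ-congʳ {a ∷ p} {a′ ∷ p′} q e with coeff-≡ e zero
... | refl = +ₚ-congˡ (scale a q) (∷-cong false (*ₚ-congʳ q (∷-injectiveʳ e)))

*ₚ-congˡ : ∀ p {q q′} → q ≐ q′ → p *ₚ q ≐ p *ₚ q′
*ₚ-congˡ [] e = ≐-refl
*ₚ-congˡ (a ∷ p) e = +ₚ-cong (scale-cong a e) (∷-cong false (*ₚ-congˡ p e))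

*ₚ-cong : ∀ {p p′ q q′} → p ≐ p′ → q ≐ q′ → p *ₚ q ≐ p′ *ₚ q′
*ₚ-cong {p′ = p′} {q} e f = ≐-trans (*ₚ-congʳ q e) (*ₚ-congˡ p′ f)

*ₚ-distribʳ : ∀ p q r → (p +ₚ q) *ₚ r ≐ p *ₚ r +ₚ q *ₚ r
*ₚ-distribʳ [] q r = ≐-refl
*ₚ-distribʳ (a ∷ p) [] r = ≐-reflexive (sym (+ₚ-identityʳ _))
*ₚ-distribʳ (a ∷ p) (b ∷ q) r = begin
  scale (a xor b) r +ₚ (false ∷ (p +ₚ q) *ₚ r)
    ≈⟨ +ₚ-cong (scale-xor a b r) (∷-cong false (*ₚ-distribʳ p q r)) ⟩
  (scale a r +ₚ scale b r) +ₚ ((false ∷ p *ₚ r) +ₚ (false ∷ q *ₚ r))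
    ≈⟨ +ₚ-Props.interchange (scale a r) (scale b r) _ _ ⟩
  (scale a r +ₚ (false ∷ p *ₚ r)) +ₚ (scale b r +ₚ (false ∷ q *ₚ r))
    ∎
  where open ≐-Reasoning

*ₚ-distribˡ : ∀ p q r → p *ₚ (q +ₚ r) ≐ p *ₚ q +ₚ p *ₚ r
*ₚ-distribˡ [] q r = ≐-refl
*ₚ-distribˡ (a ∷ p) q r = begin
  scale a (q +ₚ r) +ₚ (false ∷ p *ₚ (q +ₚ r))
    ≈⟨ +ₚ-cong (≐-reflexive (scale-+ₚ a q r)) (∷-cong false (*ₚ-distribˡ p q r)) ⟩
  (scale a q +ₚ scale a r) +ₚ ((false ∷ p *ₚ q) +ₚ (false ∷ p *ₚ r))
    ≈⟨ +ₚ-Props.interchange (scale a q) (scale a r) _ _ ⟩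
  (scale a q +ₚ (false ∷ p *ₚ q)) +ₚ (scale a r +ₚ (false ∷ p *ₚ r))
    ∎
  where open ≐-Reasoning

*ₚ-zeroʳ : ∀ p → p *ₚ [] ≐ []
*ₚ-zeroʳ [] = ≐-refl
*ₚ-zeroʳ (a ∷ p) = begin
  scale a [] +ₚ (false ∷ p *ₚ [])  ≈⟨ +ₚ-cong (scale-[] a) (∷-cong false (*ₚ-zeroʳ p)) ⟩
  [] +ₚ (false ∷ [])               ≈⟨ ≐-sym []≐false∷[] ⟩
  []                               ∎
  where
  open ≐-Reasoning
  scale-[] : ∀ a → scale a [] ≐ []
  scale-[] true = ≐-refl
  scale-[] false = ≐-refl

*ₚ-constantʳ : ∀ p b → p *ₚ (b ∷ []) ≐ scale b p
*ₚ-constantʳ [] true = ≐-refl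
*ₚ-constantʳ [] false = ≐-refl
*ₚ-constantʳ (true ∷ p) true = ∷-cong true (*ₚ-constantʳ p true)
*ₚ-constantʳ (false ∷ p) true = ∷-cong false (*ₚ-constantʳ p true)
*ₚ-constantʳ (true ∷ p) false = ≐-trans (∷-cong false (*ₚ-constantʳ p false)) (≐-sym []≐false∷[])
*ₚ-constantʳ (false ∷ p) false = ≐-trans (∷-cong false (*ₚ-constantʳ p false)) (≐-sym []≐false∷[])

*ₚ-shiftʳ : ∀ p q → p *ₚ (false ∷ q) ≐ false ∷ p *ₚ q
*ₚ-shiftʳ [] q = []≐false∷[]
*ₚ-shiftʳ (true ∷ p) q = ∷-cong false (+ₚ-congˡ q (*ₚ-shiftʳ p q))
*ₚ-shiftʳ (false ∷ p) q = ∷-cong false (*ₚ-shiftʳ p q)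

*ₚ-comm : ∀ p q → p *ₚ q ≐ q *ₚ p
*ₚ-comm [] q = ≐-sym (*ₚ-zeroʳ q)
*ₚ-comm (a ∷ p) q = begin
  scale a q +ₚ (false ∷ p *ₚ q)      ≈⟨ +ₚ-cong (≐-sym (*ₚ-constantʳ q a)) (∷-cong false (*ₚ-comm p q)) ⟩
  q *ₚ (a ∷ []) +ₚ (false ∷ q *ₚ p)  ≈⟨ +ₚ-congˡ (q *ₚ (a ∷ [])) (≐-sym (*ₚ-shiftʳ q p)) ⟩
  q *ₚ (a ∷ []) +ₚ q *ₚ (false ∷ p)  ≈⟨ *ₚ-distribˡ q (a ∷ []) (false ∷ p) ⟨
  q *ₚ ((a ∷ []) +ₚ (false ∷ p))     ≡⟨ cong (q *ₚ_) (∷-+ₚ a [] p) ⟨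
  q *ₚ (a ∷ p)                       ∎
  where open ≐-Reasoning

*ₚ-assoc : ∀ p q r → (p *ₚ q) *ₚ r ≐ p *ₚ (q *ₚ r)
*ₚ-assoc [] q r = ≐-refl
*ₚ-assoc (a ∷ p) q r = begin
  (scale a q +ₚ (false ∷ p *ₚ q)) *ₚ r     ≈⟨ *ₚ-distribʳ (scale a q) (false ∷ p *ₚ q) r ⟩
  scale a q *ₚ r +ₚ (false ∷ (p *ₚ q) *ₚ r) ≈⟨ +ₚ-cong (≐-reflexive (scale-*ₚ a q r)) (∷-cong false (*ₚ-assoc p q r)) ⟩
  scale a (q *ₚ r) +ₚ (false ∷ p *ₚ (q *ₚ r)) ∎
  where open ≐-Reasoning

*ₚ-constantˡ : ∀ b p → (b ∷ []) *ₚ p ≐ scale b p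
*ₚ-constantˡ b p = begin
  scale b p +ₚ (false ∷ [])  ≈⟨ +ₚ-congˡ (scale b p) (≐-sym []≐false∷[]) ⟩
  scale b p +ₚ []            ≡⟨ +ₚ-identityʳ (scale b p) ⟩
  scale b p                  ∎
  where open ≐-Reasoning

*ₚ-identityˡ : ∀ p → oneₚ *ₚ p ≐ p
*ₚ-identityˡ = *ₚ-constantˡ true

*ₚ-identityʳ : ∀ p → p *ₚ oneₚ ≐ p
*ₚ-identityʳ p = ≐-trans (*ₚ-comm p oneₚ) (*ₚ-identityˡ p)

^ₚ-+ : ∀ m a b → m ^ₚ a *ₚ m ^ₚ b ≐ m ^ₚ (a + b)
^ₚ-+ m zero b = *ₚ-identityˡ (m ^ₚ b)
^ₚ-+ m (suc a) b = ≐-trans (*ₚ-assoc m (m ^ₚ a) (m ^ₚ b)) (*ₚ-congˡ m (^ₚ-+ m a b))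

*ₚ-commutativeSemigroup : CommutativeSemigroup _ _
*ₚ-commutativeSemigroup = record
  { Carrier = Poly ; _≈_ = _≐_ ; _∙_ = _*ₚ_
  ; isCommutativeSemigroup = record
    { isSemigroup = record
      { isMagma = record { isEquivalence = Setoid.isEquivalence ≐-setoid ; ∙-cong = *ₚ-cong }
      ; assoc = *ₚ-assoc }
    ; comm = *ₚ-comm } }

-- Divisibility and primes

open import Algebra.Properties.CommutativeSemigroup.Divisibility *ₚ-commutativeSemigroup
module *ₚ-Props = CommSemigroupProps *ₚ-commutativeSemigroup

∣-+ₚ : ∀ {f p q} → f ∣ p → f ∣ q → f ∣ p +ₚ q
∣-+ₚ {f} (a , af≐p) (b , bf≐q) = a +ₚ b , ≐-trans (*ₚ-distribʳ a b f) (+ₚ-cong af≐p bf≐q)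

∣-*ₚʳ : ∀ {f p} q → f ∣ p → f ∣ p *ₚ q
∣-*ₚʳ {f} {p} q f∣p = ∣ʳ-respʳ-≈ (*ₚ-comm q p) (x∣ʳy⇒x∣ʳzy q f∣p)

Prime : Poly → Set
Prime g = ∀ p q → g ∣ p *ₚ q → g ∣ p ⊎ g ∣ q

Prime-resp-≐ : ∀ {g g′} → g ≐ g′ → Prime g → Prime g′
Prime-resp-≐ g≐g′ prime p q g′∣pq with prime p q (∣ʳ-respˡ-≈ (≐-sym g≐g′) g′∣pq)
... | inj₁ g∣p = inj₁ (∣ʳ-respˡ-≈ g≐g′ g∣p)
... | inj₂ g∣q = inj₂ (∣ʳ-respˡ-≈ g≐g′ g∣q)

-- Normal forms and size

trimCons : Bool → Poly → Poly
trimCons c [] = if c then true ∷ [] else []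
trimCons c (q ∷ qs) = c ∷ q ∷ qs

norm-∷ : ∀ c p → norm (c ∷ p) ≡ trimCons c (norm p)
norm-∷ c p with norm p
... | [] = refl
... | q ∷ qs = refl

coeff-trimCons : ∀ c q n → coeff (trimCons c q) n ≡ coeff (c ∷ q) n
coeff-trimCons true [] zero = refl
coeff-trimCons true [] (suc n) = refl
coeff-trimCons false [] zero = refl
coeff-trimCons false [] (suc n) = refl
coeff-trimCons c (x ∷ q) n = refl

coeff-norm : ∀ p n → coeff (norm p) n ≡ coeff p n
coeff-norm [] n = refl
coeff-norm (c ∷ p) zero rewrite norm-∷ c p = coeff-trimCons c (norm p) zero
coeff-norm (c ∷ p) (suc n) rewrite norm-∷ c p = trans (coeff-trimCons c (norm p) (suc n)) (coeff-norm p n)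

norm-≐ : ∀ p → norm p ≐ p
norm-≐ p = mk≐ (coeff-norm p)

≈⇒≐ : ∀ {p q} → p ≈ q → p ≐ q
≈⇒≐ {p} {q} e = ≐-trans (≐-sym (norm-≐ p)) (≐-trans (≐-reflexive e) (norm-≐ q))

≐[]⇒norm≡[] : ∀ {p} → p ≐ [] → norm p ≡ []
≐[]⇒norm≡[] {[]} e = refl
≐[]⇒norm≡[] {c ∷ p} e with coeff-≡ e zero
... | refl rewrite norm-∷ false p | ≐[]⇒norm≡[] (∷≐[]⇒≐[] e) = refl

≐⇒≈ : ∀ {p q} → p ≐ q → p ≈ q
≐⇒≈ {[]} e = sym (≐[]⇒norm≡[] (≐-sym e))
≐⇒≈ {a ∷ p} {[]} e = ≐[]⇒norm≡[] e
≐⇒≈ {a ∷ p} {b ∷ q} e with coeff-≡ e zero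
... | refl rewrite norm-∷ a p | norm-∷ a q | ≐⇒≈ (∷-injectiveʳ e) = refl

size-cong : ∀ {p q} → p ≐ q → size p ≡ size q
size-cong e = cong length (≐⇒≈ e)

coeff-≥length : ∀ (xs : Poly) {n} → length xs ≤ n → coeff xs n ≡ false
coeff-≥length [] _ = refl
coeff-≥length (x ∷ xs) (s≤s le) = coeff-≥length xs le

coeff-≥size : ∀ p {n} → size p ≤ n → coeff p n ≡ false
coeff-≥size p {n} le = trans (sym (coeff-norm p n)) (coeff-≥length (norm p) le)

coeff-top : ∀ p {k} → size p ≡ suc k → coeff p k ≡ true
coeff-top p {k} e = trans (sym (coeff-norm p k)) (top-of-norm p e)
  where
  top-of-trimCons : ∀ c q {k} → (∀ {j} → length q ≡ suc j → coeff q j ≡ true) →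
                    length (trimCons c q) ≡ suc k → coeff (trimCons c q) k ≡ true
  top-of-trimCons true [] {zero} h e = refl
  top-of-trimCons c (x ∷ q) {suc k} h e = h (cong pred e)
  top-of-norm : ∀ p {k} → size p ≡ suc k → coeff (norm p) k ≡ true
  top-of-norm (c ∷ p) e rewrite norm-∷ c p = top-of-trimCons c (norm p) (top-of-norm p) e

size-unique : ∀ p {k} → coeff p k ≡ true → (∀ {n} → k < n → coeff p n ≡ false) → size p ≡ suc k
size-unique p {k} top above with <-cmp (size p) (suc k)
... | tri≈ _ e _ = e
... | tri< lt _ _ with () ← trans (sym top) (coeff-≥size p (≤-pred lt))
... | tri> _ _ gt with size p in e
...   | suc s with () ← trans (sym (coeff-top p e)) (above (≤-pred gt))

size≡0⇒≐[] : ∀ p → size p ≡ 0 → p ≐ []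
size≡0⇒≐[] p e = mk≐ λ n → coeff-≥size p (subst (_≤ n) (sym e) z≤n)

size-∷ : ∀ c p {k} → size p ≡ suc k → size (c ∷ p) ≡ suc (suc k)
size-∷ c p e rewrite norm-∷ c p with norm p
... | x ∷ xs = cong suc e

size-+ₚ-dominant : ∀ p q {k} → size p ≤ k → size q ≡ suc k → size (p +ₚ q) ≡ suc k
size-+ₚ-dominant p q {k} le e = size-unique (p +ₚ q) top above
  where
  top : coeff (p +ₚ q) k ≡ true
  top = trans (coeff-+ₚ p q k) (cong₂ _xor_ (coeff-≥size p le) (coeff-top q e))
  above : ∀ {n} → k < n → coeff (p +ₚ q) n ≡ false
  above {n} lt = trans (coeff-+ₚ p q n)
    (cong₂ _xor_ (coeff-≥size p (≤-trans le (≤-trans (n≤1+n k) lt)))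
                 (coeff-≥size q (subst (_≤ n) (sym e) lt)))

size-scale : ∀ c q → size (scale c q) ≤ size q
size-scale true q = ≤-refl
size-scale false q = z≤n

size-*ₚ : ∀ p q {a b} → size p ≡ suc a → size q ≡ suc b → size (p *ₚ q) ≡ suc (a + b)
size-*ₚ (c ∷ p) q {a} {b} sp sq with size p in e
... | zero = constant c (trans (sym (size-cong (∷-cong c (size≡0⇒≐[] p e)))) sp)
  where
  constant : ∀ c → size (c ∷ []) ≡ suc a → size ((c ∷ p) *ₚ q) ≡ suc (a + b)
  constant true refl = trans (size-cong (≐-trans (*ₚ-congʳ q (∷-cong true (size≡0⇒≐[] p e))) (*ₚ-identityˡ q))) sq
... | suc a′ with trans (sym (size-∷ c p e)) sp
...   | refl = size-+ₚ-dominant (scale c q) (false ∷ p *ₚ q)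
                 (≤-trans (size-scale c q) (subst (_≤ suc (a′ + b)) (sym sq) (s≤s (m≤n+m b a′))))
                 (size-∷ false (p *ₚ q) (size-*ₚ p q e sq))

size-^ₚ : ∀ p {d} n → size p ≡ suc d → size (p ^ₚ n) ≡ suc (n * d)
size-^ₚ p zero e = refl
size-^ₚ p (suc n) e = size-*ₚ p (p ^ₚ n) e (size-^ₚ p n e)

size-≤ : ∀ p {k} → (∀ {n} → k ≤ n → coeff p n ≡ false) → size p ≤ k
size-≤ p {k} vanish with size p in e
... | zero = z≤n
... | suc s with s <? k
...   | yes s<k = s<k
...   | no s≮k with () ← trans (sym (coeff-top p e)) (vanish (≮⇒≥ s≮k))

multiple-of-larger-size : ∀ {g d} q r → size g ≡ suc d → size r ≤ d → q *ₚ g ≐ r → r ≐ []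
multiple-of-larger-size {g} {d} q r sg sr e with size q in sq
... | zero = ≐-trans (≐-sym e) (*ₚ-zeroˡ g (size≡0⇒≐[] q sq))
... | suc b = ⊥-elim (≤⇒≯ (subst (_≤ d) (trans (size-cong (≐-sym e)) (size-*ₚ q g sq sg)) sr)
                        (s≤s (m≤n+m d b)))

-- Division by a monic polynomial

xⁿ : ℕ → Poly
xⁿ zero = true ∷ []
xⁿ (suc n) = false ∷ xⁿ n

toList-zipWith-xor : ∀ {d} (u v : Vec Bool d) → toList (zipWith _xor_ u v) ≡ toList u +ₚ toList v
toList-zipWith-xor []ᵥ []ᵥ = refl
toList-zipWith-xor (x ∷ᵥ u) (y ∷ᵥ v) = cong ((x xor y) ∷_) (toList-zipWith-xor u v)

toList-≐-injective : ∀ {d} (u v : Vec Bool d) → toList u ≐ toList v → u ≡ v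
toList-≐-injective []ᵥ []ᵥ e = refl
toList-≐-injective (x ∷ᵥ u) (y ∷ᵥ v) e with coeff-≡ e zero
... | refl = cong (x ∷ᵥ_) (toList-≐-injective u v (∷-injectiveʳ e))

size-toList : ∀ {d} (v : Vec Bool d) → size (toList v) ≤ d
size-toList {d} v = size-≤ (toList v) λ le → coeff-≥length (toList v) (subst (_≤ _) (sym (length-toList v)) le)

size-xⁿ : ∀ n → size (xⁿ n) ≡ suc n
size-xⁿ zero = refl
size-xⁿ (suc n) = size-∷ false (xⁿ n) (size-xⁿ n)

shift : ∀ {k} → Bool → Vec Bool k → Vec Bool k × Bool
shift c []ᵥ = []ᵥ , c
shift c (x ∷ᵥ r) = map₁ (c ∷ᵥ_) (shift x r)

shift-correct : ∀ {k} c (r : Vec Bool k) →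
  c ∷ toList r ≐ toList (proj₁ (shift c r)) +ₚ scale (proj₂ (shift c r)) (xⁿ k)
shift-correct true []ᵥ = ≐-refl
shift-correct false []ᵥ = ≐-sym []≐false∷[]
shift-correct {suc k} c (x ∷ᵥ r) = begin
  c ∷ x ∷ toList r                             ≈⟨ ∷-cong c (shift-correct x r) ⟩
  c ∷ (toList r′ +ₚ scale t (xⁿ k))            ≡⟨ ∷-+ₚ c (toList r′) (scale t (xⁿ k)) ⟩
  (c ∷ toList r′) +ₚ (false ∷ scale t (xⁿ k))  ≈⟨ +ₚ-congˡ (c ∷ toList r′) (shift-scale t) ⟩
  (c ∷ toList r′) +ₚ scale t (xⁿ (suc k))      ∎
  where
  open ≐-Reasoning
  r′ = proj₁ (shift x r)
  t = proj₂ (shift x r)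
  shift-scale : ∀ t → false ∷ scale t (xⁿ k) ≐ scale t (false ∷ xⁿ k)
  shift-scale true = ≐-refl
  shift-scale false = ≐-sym []≐false∷[]

module Monic {d : ℕ} (lo : Vec Bool d) where

  g : Poly
  g = toList lo ++ true ∷ []

  g≐lo+xᵈ : g ≐ toList lo +ₚ xⁿ d
  g≐lo+xᵈ = split lo
    where
    split : ∀ {k} (v : Vec Bool k) → toList v ++ true ∷ [] ≐ toList v +ₚ xⁿ k
    split []ᵥ = ≐-refl
    split (x ∷ᵥ v) = ≐-trans (∷-cong x (split v)) (≐-reflexive (∷-+ₚ x (toList v) _))

  size-g : size g ≡ suc d
  size-g = trans (size-cong g≐lo+xᵈ) (size-+ₚ-dominant (toList lo) (xⁿ d) (size-toList lo) (size-xⁿ d))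

  0ᵥ : Vec Bool d
  0ᵥ = replicateᵥ d false

  toList-0ᵥ : toList 0ᵥ ≐ []
  toList-0ᵥ = ≐-trans (≐-reflexive (toList-replicate d false)) (replicate-false≐[] d)

  reduce : Vec Bool d × Bool → Vec Bool d
  reduce (r′ , true) = zipWith _xor_ r′ lo
  reduce (r′ , false) = r′

  step : Bool → Vec Bool d → Vec Bool d
  step c r = reduce (shift c r)

  step-correct : ∀ c r → c ∷ toList r ≐ toList (step c r) +ₚ scale (proj₂ (shift c r)) g
  step-correct c r = ≐-trans (shift-correct c r) (reduce-correct (shift c r))
    where
    open ≐-Reasoning
    reduce-correct : ∀ rt → toList (proj₁ rt) +ₚ scale (proj₂ rt) (xⁿ d) ≐ toList (reduce rt) +ₚ scale (proj₂ rt) g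
    reduce-correct (r′ , false) = ≐-refl
    reduce-correct (r′ , true) = begin
      toList r′ +ₚ xⁿ d                             ≈⟨ +ₚ-cancel-middle (toList r′) (toList lo) (xⁿ d) ⟨
      (toList r′ +ₚ toList lo) +ₚ (toList lo +ₚ xⁿ d) ≈⟨ +ₚ-cong (≐-reflexive (sym (toList-zipWith-xor r′ lo))) (≐-sym g≐lo+xᵈ) ⟩
      toList (zipWith _xor_ r′ lo) +ₚ g             ∎

  rem : Poly → Vec Bool d
  rem [] = 0ᵥ
  rem (c ∷ p) = step c (rem p)

  division : ∀ p → ∃ λ q → p ≐ q *ₚ g +ₚ toList (rem p)
  division [] = [] , ≐-sym toList-0ᵥ
  -- The first step is by computation: (false ∷ a) +ₚ (c ∷ b) reduces to c ∷ (a +ₚ b).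
  division (c ∷ p) with division p
  ... | q , e = (false ∷ q) +ₚ (t ∷ []) , (begin
    c ∷ p
      ≈⟨ ∷-cong c e ⟩
    (false ∷ q *ₚ g) +ₚ (c ∷ toList r)
      ≈⟨ +ₚ-congˡ (false ∷ q *ₚ g) (step-correct c r) ⟩
    (false ∷ q *ₚ g) +ₚ (toList (step c r) +ₚ scale t g)
      ≈⟨ +ₚ-Props.x∙yz≈xz∙y (false ∷ q *ₚ g) (toList (step c r)) (scale t g) ⟩
    ((false ∷ q *ₚ g) +ₚ scale t g) +ₚ toList (step c r)
      ≈⟨ +ₚ-congʳ (toList (step c r)) (+ₚ-congˡ (false ∷ q *ₚ g) (*ₚ-constantˡ t g)) ⟨
    ((false ∷ q) *ₚ g +ₚ (t ∷ []) *ₚ g) +ₚ toList (step c r)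
      ≈⟨ +ₚ-congʳ (toList (step c r)) (*ₚ-distribʳ (false ∷ q) (t ∷ []) g) ⟨
    ((false ∷ q) +ₚ (t ∷ [])) *ₚ g +ₚ toList (step c r)
      ∎)
    where
    open ≐-Reasoning
    r = rem p
    t = proj₂ (shift c r)

  remainder-unique : ∀ p q w → p ≐ q *ₚ g +ₚ toList w → rem p ≡ w
  remainder-unique p q w e with division p
  ... | q′ , e′ = sym (toList-≐-injective w (rem p) (+ₚ≐[]⇒≐ (≐-trans (≐-reflexive (sym (toList-zipWith-xor w (rem p)))) w+r≐[])))
    where
    open ≐-Reasoning
    multiple : (q +ₚ q′) *ₚ g ≐ toList (zipWith _xor_ w (rem p))
    multiple = begin
      (q +ₚ q′) *ₚ g               ≈⟨ *ₚ-distribʳ q q′ g ⟩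
      q *ₚ g +ₚ q′ *ₚ g            ≈⟨ +ₚ-transpose (q *ₚ g) (toList w) (q′ *ₚ g) (toList (rem p)) (≐-trans (≐-sym e) e′) ⟩
      toList w +ₚ toList (rem p)   ≡⟨ toList-zipWith-xor w (rem p) ⟨
      toList (zipWith _xor_ w (rem p)) ∎
    w+r≐[] : toList (zipWith _xor_ w (rem p)) ≐ []
    w+r≐[] = multiple-of-larger-size (q +ₚ q′) _ size-g (size-toList (zipWith _xor_ w (rem p))) multiple

  rem-cong : ∀ {p p′} → p ≐ p′ → rem p ≡ rem p′
  rem-cong {p} {p′} e with division p′
  ... | q , e′ = remainder-unique p q (rem p′) (≐-trans e e′)

  rem-multiple-+ₚ : ∀ q p → rem (q *ₚ g +ₚ p) ≡ rem p
  rem-multiple-+ₚ q p with division p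
  ... | q′ , e = remainder-unique _ (q +ₚ q′) (rem p) (begin
    q *ₚ g +ₚ p                           ≈⟨ +ₚ-congˡ (q *ₚ g) e ⟩
    q *ₚ g +ₚ (q′ *ₚ g +ₚ toList (rem p))  ≡⟨ +ₚ-assoc (q *ₚ g) (q′ *ₚ g) _ ⟨
    (q *ₚ g +ₚ q′ *ₚ g) +ₚ toList (rem p)  ≈⟨ +ₚ-cong (*ₚ-distribʳ q q′ g) ≐-refl ⟨
    (q +ₚ q′) *ₚ g +ₚ toList (rem p)       ∎)
    where open ≐-Reasoning

  ∣⇒rem≡0ᵥ : ∀ {p} → g ∣ p → rem p ≡ 0ᵥ
  ∣⇒rem≡0ᵥ {p} (q , qg≐p) = begin
    rem p                        ≡⟨ rem-cong (≐-trans (≐-sym qg≐p) (≐-sym (≐-reflexive (+ₚ-identityʳ _)))) ⟩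
    rem (q *ₚ g +ₚ [])           ≡⟨ rem-multiple-+ₚ q [] ⟩
    0ᵥ                           ∎
    where open ≡-Reasoning

  rem≡0ᵥ⇒∣ : ∀ {p} → rem p ≡ 0ᵥ → g ∣ p
  rem≡0ᵥ⇒∣ {p} r≡0 with division p
  ... | q , e = q , ≐-sym (begin
    p                         ≈⟨ e ⟩
    q *ₚ g +ₚ toList (rem p)  ≈⟨ +ₚ-congˡ (q *ₚ g) (≐-trans (≐-reflexive (cong toList r≡0)) toList-0ᵥ) ⟩
    q *ₚ g +ₚ []              ≡⟨ +ₚ-identityʳ _ ⟩
    q *ₚ g                    ∎)
    where open ≐-Reasoning

  rem-*ₚ : ∀ p q → rem (p *ₚ q) ≡ rem (toList (rem p) *ₚ q)
  rem-*ₚ p q with division p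
  ... | a , e = trans (rem-cong (begin
    p *ₚ q                                  ≈⟨ *ₚ-congʳ q e ⟩
    (a *ₚ g +ₚ toList (rem p)) *ₚ q          ≈⟨ *ₚ-distribʳ (a *ₚ g) _ q ⟩
    (a *ₚ g) *ₚ q +ₚ toList (rem p) *ₚ q     ≈⟨ +ₚ-cong (*ₚ-Props.xy∙z≈xz∙y a g q) ≐-refl ⟩
    (a *ₚ q) *ₚ g +ₚ toList (rem p) *ₚ q     ∎))
    (rem-multiple-+ₚ (a *ₚ q) _)
    where open ≐-Reasoning

  rem-*ₚ-congʳ : ∀ p p′ q → rem p ≡ rem p′ → rem (p *ₚ q) ≡ rem (p′ *ₚ q)
  rem-*ₚ-congʳ p p′ q e = trans (rem-*ₚ p q) (trans (cong (λ v → rem (toList v *ₚ q)) e) (sym (rem-*ₚ p′ q)))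

  infix 4 _≟ᵥ_
  _≟ᵥ_ : (u v : Vec Bool d) → Dec (u ≡ v)
  _≟ᵥ_ = ≡-decᵥ _≟ᵇ_

  infixl 7 _·_
  _·_ : Vec Bool d → Vec Bool d → Vec Bool d
  u · v = rem (toList u *ₚ toList v)

  InvertibleResidues : Set
  InvertibleResidues = ∀ v → v ≢ 0ᵥ → ∃ λ w → v · w ≡ rem oneₚ

  invertible⇒prime : InvertibleResidues → Prime g
  invertible⇒prime inv p q g∣pq with rem p ≟ᵥ 0ᵥ
  ... | yes rp≡0 = inj₁ (rem≡0ᵥ⇒∣ rp≡0)
  ... | no rp≢0 with inv (rem p) rp≢0
  ...   | w , rp·w≡1 = inj₂ (rem≡0ᵥ⇒∣ (begin
    rem q                          ≡⟨ rem-cong (≐-sym (*ₚ-identityˡ q)) ⟩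
    rem (oneₚ *ₚ q)                ≡⟨ rem-*ₚ-congʳ (p *ₚ toList w) oneₚ q (trans (rem-*ₚ p (toList w)) rp·w≡1) ⟨
    rem ((p *ₚ toList w) *ₚ q)     ≡⟨ rem-cong (*ₚ-Props.xy∙z≈xz∙y p (toList w) q) ⟩
    rem ((p *ₚ q) *ₚ toList w)     ≡⟨ rem-*ₚ-congʳ (p *ₚ q) [] (toList w) (∣⇒rem≡0ᵥ g∣pq) ⟩
    rem ([] *ₚ toList w)           ∎))
    where open ≡-Reasoning

  -- For g irreducible of degree d, F₂[x]/(g) is the field with 2ᵈ elements,
  -- so v^(2 + 4 + ⋯ + 2^(d−1)) = v^(2ᵈ − 2) is the inverse of v ≠ 0.
  fermatInverse : Vec Bool d → Vec Bool d
  fermatInverse v = go (pred d) v (rem oneₚ)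
    where
    go squared : ℕ → Vec Bool d → Vec Bool d → Vec Bool d
    go zero p acc = acc
    go (suc n) p acc = squared n (p · p) acc
    squared n p² acc = go n p² (acc · p²)

  HasFermatInverse : Vec Bool d → Set
  HasFermatInverse v = v ≡ 0ᵥ ⊎ v · fermatInverse v ≡ rem oneₚ

  hasFermatInverse? : Decidable HasFermatInverse
  hasFermatInverse? v = (v ≟ᵥ 0ᵥ) ⊎-dec (v · fermatInverse v ≟ᵥ rem oneₚ)

  allHaveFermatInverse? : Dec (∀ v → HasFermatInverse v)
  allHaveFermatInverse? = map′
    (λ ¬∃ v → decidable-stable (hasFermatInverse? v) (λ ¬inv → ¬∃ (v , ¬inv)))
    (λ ∀inv (v , ¬inv) → ¬inv (∀inv v))
    (¬? (anySubset? (¬? ∘ hasFermatInverse?)))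

  fermat-invertible : (∀ v → HasFermatInverse v) → InvertibleResidues
  fermat-invertible fermat v v≢0 with fermat v
  ... | inj₁ v≡0 = ⊥-elim (v≢0 v≡0)
  ... | inj₂ v·v⁻¹≡1 = fermatInverse v , v·v⁻¹≡1

lowCoeffs : (m : Poly) → Vec Bool (pred (size m))
lowCoeffs m = tabulate (coeff m ∘ toℕ)

-- True of every nonzero f, since over F₂ the leading coefficient is 1; it is checked below for the members of 𝓕.
MonicRep : Poly → Set
MonicRep f = Monic.g (lowCoeffs f) ≐ f

infix 4 _∣ᵣ_ _∣ᵣ?_
_∣ᵣ_ : Poly → Poly → Set
f ∣ᵣ p = Monic.rem (lowCoeffs f) p ≡ Monic.0ᵥ (lowCoeffs f)

_∣ᵣ?_ : ∀ f p → Dec (f ∣ᵣ p)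
f ∣ᵣ? p = Monic._≟ᵥ_ (lowCoeffs f) _ _

∣⇒∣ᵣ : ∀ {f p} → MonicRep f → f ∣ p → f ∣ᵣ p
∣⇒∣ᵣ {f} g≐f f∣p = Monic.∣⇒rem≡0ᵥ (lowCoeffs f) (∣ʳ-respˡ-≈ (≐-sym g≐f) f∣p)

-- Divisors of prime powers

*ₚ-noZeroDivisors : ∀ f {a} p → size f ≡ suc a → f *ₚ p ≐ [] → p ≐ []
*ₚ-noZeroDivisors f p sf fp≐[] with size p in sp
... | zero = size≡0⇒≐[] p sp
... | suc b with () ← trans (sym (size-*ₚ f p sf sp)) (size-cong fp≐[])

*ₚ-cancelˡ : ∀ f {a} p q → size f ≡ suc a → f *ₚ p ≐ f *ₚ q → p ≐ q
*ₚ-cancelˡ f p q sf e = +ₚ≐[]⇒≐ (*ₚ-noZeroDivisors f (p +ₚ q) sf (begin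
  f *ₚ (p +ₚ q)       ≈⟨ *ₚ-distribˡ f p q ⟩
  f *ₚ p +ₚ f *ₚ q    ≈⟨ +ₚ-congʳ (f *ₚ q) e ⟩
  f *ₚ q +ₚ f *ₚ q    ≈⟨ +ₚ-self (f *ₚ q) ⟩
  []                  ∎))
  where open ≐-Reasoning

size≡1⇒≐oneₚ : ∀ p → size p ≡ 1 → p ≐ oneₚ
size≡1⇒≐oneₚ p e = mk≐ λ
  { zero → coeff-top p e
  ; (suc n) → coeff-≥size p (subst (_≤ suc n) (sym e) (s≤s z≤n)) }

unit-divisor : ∀ p q → p *ₚ q ≐ oneₚ → p ≐ oneₚ
unit-divisor p q e with size p in sp | size q in sq
... | zero | _ with () ← trans (sym (size-cong e)) (size-cong (*ₚ-zeroˡ q (size≡0⇒≐[] p sp)))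
... | suc a | zero with () ← trans (sym (size-cong e))
                               (size-cong (≐-trans (*ₚ-congˡ p (size≡0⇒≐[] q sq)) (*ₚ-zeroʳ p)))
... | suc a | suc b = size≡1⇒≐oneₚ p (trans sp (cong suc a≡0))
  where
  a≡0 : a ≡ 0
  a≡0 = m+n≡0⇒m≡0 a (cong pred (trans (sym (size-*ₚ p q sp sq)) (size-cong e)))

divisor-of-prime-power : ∀ {g a} → Prime g → size g ≡ suc a →
  ∀ n p q → p *ₚ q ≐ g ^ₚ n → ∃ λ j → j ≤ n × p ≐ g ^ₚ j
divisor-of-prime-power prime sg zero p q e = 0 , z≤n , unit-divisor p q e
divisor-of-prime-power {g} prime sg (suc n) p q e
  with prime p q (g ^ₚ n , ≐-trans (*ₚ-comm (g ^ₚ n) g) (≐-sym e))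
... | inj₁ (p′ , p′g≐p)
  with divisor-of-prime-power prime sg n p′ q
         (*ₚ-cancelˡ g (p′ *ₚ q) (g ^ₚ n) sg (≐-trans (*ₚ-Props.x∙yz≈yx∙z g p′ q) (≐-trans (*ₚ-congʳ q p′g≐p) e)))
...   | j , j≤n , p′≐gʲ = suc j , s≤s j≤n , ≐-trans (≐-sym p′g≐p) (≐-trans (*ₚ-comm p′ g) (*ₚ-congˡ g p′≐gʲ))
divisor-of-prime-power {g} prime sg (suc n) p q e | inj₂ (q′ , q′g≐q)
  with divisor-of-prime-power prime sg n p q′
         (*ₚ-cancelˡ g (p *ₚ q′) (g ^ₚ n) sg (≐-trans (*ₚ-Props.x∙yz≈y∙zx g p q′) (≐-trans (*ₚ-congˡ p q′g≐q) e)))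
...   | j , j≤n , p≐gʲ = j , ≤-trans j≤n (n≤1+n n) , p≐gʲ

-- The divisor sum of a prime power

pair : Poly → List Poly
pair p = (false ∷ p) ∷ (true ∷ p) ∷ []

∈-lists⁻ : ∀ n {xs} → xs ∈ lists n → length xs ≡ n
∈-lists⁻ zero (here refl) = refl
∈-lists⁻ (suc n) m with find (∈-concatMap⁻ pair {xs = lists n} m)
... | p , p∈ , here refl = cong suc (∈-lists⁻ n p∈)
... | p , p∈ , there (here refl) = cong suc (∈-lists⁻ n p∈)

∈-lists⁺ : ∀ xs → xs ∈ lists (length xs)
∈-lists⁺ [] = here refl
∈-lists⁺ (c ∷ xs) = ∈-concatMap⁺ pair (Any.map (λ { refl → ∈-pair c }) (∈-lists⁺ xs))
  where
  ∈-pair : ∀ c → (c ∷ xs) ∈ pair xs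
  ∈-pair false = here refl
  ∈-pair true = there (here refl)

lists-unique : ∀ n → Unique (lists n)
lists-unique zero = All.[] AllPairs.∷ AllPairs.[]
lists-unique (suc n) = concatMap-pair-unique (lists n) (lists-unique n)
  where
  concatMap-pair-unique : ∀ xs → Unique xs → Unique (concatMap pair xs)
  concatMap-pair-unique [] _ = AllPairs.[]
  concatMap-pair-unique (x ∷ xs) (x∉xs AllPairs.∷ u) =
    ((λ ()) All.∷ All.tabulate (fresh false)) AllPairs.∷ (All.tabulate (fresh true) AllPairs.∷ concatMap-pair-unique xs u)
    where
    fresh : ∀ c {y} → y ∈ concatMap pair xs → c ∷ x ≢ y
    fresh c y∈ refl with find (∈-concatMap⁻ pair {xs = xs} y∈)
    ... | p , p∈ , here refl = All.lookup x∉xs p∈ refl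
    ... | p , p∈ , there (here refl) = All.lookup x∉xs p∈ refl

eqL⇔≡ : ∀ xs ys → T (eqL xs ys) ⇔ xs ≡ ys
eqL⇔≡ xs ys = mk⇔ (sound xs ys) (λ { refl → complete xs })
  where
  sound : ∀ xs ys → T (eqL xs ys) → xs ≡ ys
  sound [] [] _ = refl
  sound (true ∷ xs) (true ∷ ys) t = cong (true ∷_) (sound xs ys t)
  sound (false ∷ xs) (false ∷ ys) t = cong (false ∷_) (sound xs ys t)
  complete : ∀ xs → T (eqL xs xs)
  complete [] = _
  complete (true ∷ xs) = complete xs
  complete (false ∷ xs) = complete xs

==⇔≐ : ∀ p q → T (p == q) ⇔ p ≐ q
==⇔≐ p q = mk⇔ (≈⇒≐ ∘ Equivalence.to (eqL⇔≡ (norm p) (norm q)))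
                (Equivalence.from (eqL⇔≡ (norm p) (norm q)) ∘ ≐⇒≈)

isZero⇔≐[] : ∀ p → T (isZero p) ⇔ p ≐ []
isZero⇔≐[] p = mk⇔ (λ t → ≐-trans (≐-sym (norm-≐ p)) (Equivalence.to (==⇔≐ (norm p) []) t))
                   (λ e → Equivalence.from (==⇔≐ (norm p) []) (≐-trans (norm-≐ p) e))

pad : ℕ → Poly → Poly
pad s x = x ++ replicate (s ∸ length x) false

++-zeros-≐ : ∀ x k → x ++ replicate k false ≐ x
++-zeros-≐ [] k = replicate-false≐[] k
++-zeros-≐ (c ∷ x) k = ∷-cong c (++-zeros-≐ x k)

pad-≐ : ∀ s x → pad s x ≐ x
pad-≐ s x = ++-zeros-≐ x (s ∸ length x)

length-pad : ∀ s x → length x ≤ s → length (pad s x) ≡ s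
length-pad s x le = trans (length-++ x) (trans (cong (length x +_) (length-replicate (s ∸ length x))) (m+[n∸m]≡n le))

≐-length-injective : ∀ {x y} → length x ≡ length y → x ≐ y → x ≡ y
≐-length-injective {[]} {[]} _ _ = refl
≐-length-injective {a ∷ x} {b ∷ y} l e with coeff-≡ e zero
... | refl = cong (a ∷_) (≐-length-injective (cong pred l) (∷-injectiveʳ e))

dividesB-sound : ∀ D A → T (dividesB D A) → D ∣ A
dividesB-sound D A t with Any.satisfied (any⁻ _ (lists (size A)) t)
... | Q , DQ==A = Q , ≐-trans (*ₚ-comm Q D) (Equivalence.to (==⇔≐ (D *ₚ Q) A) DQ==A)

dividesB-complete : ∀ D A Q → size Q ≤ size A → D *ₚ Q ≐ A → T (dividesB D A)
dividesB-complete D A Q le DQ≐A = any⁺ _ (lose padQ∈ (Equivalence.from (==⇔≐ (D *ₚ padQ) A) DpadQ≐A))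
  where
  padQ = pad (size A) (norm Q)
  padQ∈ : padQ ∈ lists (size A)
  padQ∈ = subst (λ k → padQ ∈ lists k) (length-pad (size A) (norm Q) le) (∈-lists⁺ padQ)
  DpadQ≐A : D *ₚ padQ ≐ A
  DpadQ≐A = ≐-trans (*ₚ-congˡ D (≐-trans (pad-≐ (size A) (norm Q)) (norm-≐ Q))) DQ≐A

isDivisor? : Poly → Poly → Bool
isDivisor? A D = not (isZero D) ∧ dividesB D A

∈-monicDivisors⁻ : ∀ {A x} → x ∈ monicDivisors A → length x ≡ size A × x ∣ A
∈-monicDivisors⁻ {A} {x} x∈ with ∈-filter⁻ (T? ∘ isDivisor? A) {xs = lists (size A)} x∈
... | x∈lists , t = ∈-lists⁻ (size A) x∈lists , dividesB-sound x A (proj₂ (Equivalence.to T-∧ t))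

∈-monicDivisors⁺ : ∀ {A x} Q → length x ≡ size A → ¬ x ≐ [] → size Q ≤ size A → x *ₚ Q ≐ A →
                   x ∈ monicDivisors A
∈-monicDivisors⁺ {A} {x} Q len x≉0 le xQ≐A =
  ∈-filter⁺ (T? ∘ isDivisor? A) (subst (λ k → x ∈ lists k) len (∈-lists⁺ x))
    (Equivalence.from T-∧ (nonzero , dividesB-complete x A Q le xQ≐A))
  where
  nonzero : T (not (isZero x))
  nonzero with isZero x in z
  ... | false = _
  ... | true = ⊥-elim (x≉0 (Equivalence.to (isZero⇔≐[] x) (subst T (sym z) _)))

geometric : Poly → ℕ → Poly
geometric m zero = oneₚ
geometric m (suc n) = oneₚ +ₚ m *ₚ geometric m n


geometric-suc : ∀ m n → geometric m (suc n) ≐ m ^ₚ suc n +ₚ geometric m n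
geometric-suc m zero = ≐-reflexive (+ₚ-comm oneₚ (m *ₚ oneₚ))
geometric-suc m (suc n) = begin
  oneₚ +ₚ m *ₚ geometric m (suc n)                         ≈⟨ +ₚ-congˡ oneₚ (*ₚ-congˡ m (geometric-suc m n)) ⟩
  oneₚ +ₚ m *ₚ (m ^ₚ suc n +ₚ geometric m n)               ≈⟨ +ₚ-congˡ oneₚ (*ₚ-distribˡ m _ _) ⟩
  oneₚ +ₚ (m ^ₚ suc (suc n) +ₚ m *ₚ geometric m n)         ≈⟨ +ₚ-Props.x∙yz≈y∙xz oneₚ (m ^ₚ suc (suc n)) (m *ₚ geometric m n) ⟩
  m ^ₚ suc (suc n) +ₚ (oneₚ +ₚ m *ₚ geometric m n)         ∎
  where open ≐-Reasoning

sum-powers : ∀ m n → sumₚ (map (m ^ₚ_) (downFrom (suc n))) ≐ geometric m n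
sum-powers m zero = ≐-refl
sum-powers m (suc n) = ≐-trans (+ₚ-congˡ (m ^ₚ suc n) (sum-powers m n)) (≐-sym (geometric-suc m n))

sumₚ-map-≐ : ∀ {A : Set} (f h : A → Poly) → (∀ x → f x ≐ h x) → ∀ xs → sumₚ (map f xs) ≐ sumₚ (map h xs)
sumₚ-map-≐ f h f≐h [] = ≐-refl
sumₚ-map-≐ f h f≐h (x ∷ xs) = +ₚ-cong (f≐h x) (sumₚ-map-≐ f h f≐h xs)

sumₚ-↭ : ∀ {xs ys} → xs ↭ ys → sumₚ xs ≐ sumₚ ys
sumₚ-↭ p = foldr-commMonoid ≐-setoid (CommutativeMonoid.isCommutativeMonoid +ₚ-commutativeMonoid)
             (↭⇒↭ₛ′ (Setoid.isEquivalence ≐-setoid) p)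

module PrimePowerDivisors {g d} (prime : Prime g) (sg : size g ≡ suc (suc d)) (n : ℕ) where

  A : Poly
  A = g ^ₚ n

  s : ℕ
  s = size A

  -- The divisors gʲ, padded to the length s of the coefficient lists enumerated by σ A.
  padPow : ℕ → Poly
  padPow j = pad s (norm (g ^ₚ j))

  size-pow : ∀ j → size (g ^ₚ j) ≡ suc (j * suc d)
  size-pow j = size-^ₚ g j sg

  size-pow-≤ : ∀ {j} → j ≤ n → size (g ^ₚ j) ≤ s
  size-pow-≤ {j} j≤n = subst₂ _≤_ (sym (size-pow j)) (sym (size-pow n)) (s≤s (*-monoˡ-≤ (suc d) j≤n))

  padPow≐ : ∀ j → padPow j ≐ g ^ₚ j
  padPow≐ j = ≐-trans (pad-≐ s (norm (g ^ₚ j))) (norm-≐ (g ^ₚ j))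

  length-padPow : ∀ {j} → j ≤ n → length (padPow j) ≡ s
  length-padPow {j} j≤n = length-pad s (norm (g ^ₚ j)) (size-pow-≤ j≤n)

  divisors-unique : Unique (monicDivisors A)
  divisors-unique = filter⁺ (T? ∘ isDivisor? A) (lists-unique s)

  powers-unique : Unique (map padPow (downFrom (suc n)))
  powers-unique = map⁺ injective (downFrom⁺ (suc n))
    where
    injective : ∀ {i j} → padPow i ≡ padPow j → i ≡ j
    injective {i} {j} e = *-cancelʳ-≡ i j (suc d) (suc-injective
      (trans (sym (size-pow i)) (trans (size-cong gⁱ≐gʲ) (size-pow j))))
      where
      gⁱ≐gʲ : g ^ₚ i ≐ g ^ₚ j
      gⁱ≐gʲ = ≐-trans (≐-sym (padPow≐ i)) (≐-trans (≐-reflexive e) (padPow≐ j))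

  divisor⇒power : ∀ {x} → x ∈ monicDivisors A → x ∈ map padPow (downFrom (suc n))
  divisor⇒power {x} x∈ with ∈-monicDivisors⁻ x∈
  ... | len , (q , qx≐A) with divisor-of-prime-power prime sg n x q (≐-trans (*ₚ-comm x q) qx≐A)
  ...   | j , j≤n , x≐gʲ =
    subst (_∈ _) (sym (≐-length-injective (trans len (sym (length-padPow j≤n))) (≐-trans x≐gʲ (≐-sym (padPow≐ j)))))
      (∈-map⁺ padPow (∈-downFrom⁺ (s≤s j≤n)))

  power⇒divisor : ∀ {x} → x ∈ map padPow (downFrom (suc n)) → x ∈ monicDivisors A
  power⇒divisor x∈ with ∈-map⁻ padPow x∈
  ... | j , j∈ , refl = ∈-monicDivisors⁺ (g ^ₚ (n ∸ j)) (length-padPow j≤n) nonzero (size-pow-≤ (m∸n≤m n j))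
    (begin
      padPow j *ₚ g ^ₚ (n ∸ j)    ≈⟨ *ₚ-congʳ _ (padPow≐ j) ⟩
      g ^ₚ j *ₚ g ^ₚ (n ∸ j)      ≈⟨ ^ₚ-+ g j (n ∸ j) ⟩
      g ^ₚ (j + (n ∸ j))          ≡⟨ cong (g ^ₚ_) (m+[n∸m]≡n j≤n) ⟩
      A                           ∎)
    where
    open ≐-Reasoning
    j≤n : j ≤ n
    j≤n = ≤-pred (∈-downFrom⁻ j∈)
    nonzero : ¬ padPow j ≐ []
    nonzero e with () ← trans (sym (size-pow j)) (size-cong (≐-trans (≐-sym (padPow≐ j)) e))

  monicDivisors↭powers : monicDivisors A ↭ map padPow (downFrom (suc n))
  monicDivisors↭powers = ∼bag⇒↭ (unique∧set⇒bag divisors-unique powers-unique (mk⇔ divisor⇒power power⇒divisor))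

σ-prime-power : ∀ {g d} → Prime g → size g ≡ suc (suc d) → ∀ n → σ (g ^ₚ n) ≐ geometric g n
σ-prime-power {g} prime sg n = begin
  sumₚ (monicDivisors (g ^ₚ n))            ≈⟨ sumₚ-↭ monicDivisors↭powers ⟩
  sumₚ (map padPow (downFrom (suc n)))     ≈⟨ sumₚ-map-≐ padPow (g ^ₚ_) padPow≐ (downFrom (suc n)) ⟩
  sumₚ (map (g ^ₚ_) (downFrom (suc n)))    ≈⟨ sum-powers g n ⟩
  geometric g n                            ∎
  where
  open ≐-Reasoning
  open PrimePowerDivisors prime sg n

-- The formal derivative and repeated factors

deriv : Poly → Poly
deriv [] = []
deriv (c ∷ p) = p +ₚ (false ∷ deriv p)

deriv-+ₚ : ∀ p q → deriv (p +ₚ q) ≐ deriv p +ₚ deriv q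
deriv-+ₚ [] q = ≐-refl
deriv-+ₚ (a ∷ p) [] = ≐-reflexive (sym (+ₚ-identityʳ _))
deriv-+ₚ (a ∷ p) (b ∷ q) = begin
  (p +ₚ q) +ₚ (false ∷ deriv (p +ₚ q))                   ≈⟨ +ₚ-congˡ (p +ₚ q) (∷-cong false (deriv-+ₚ p q)) ⟩
  (p +ₚ q) +ₚ ((false ∷ deriv p) +ₚ (false ∷ deriv q))   ≈⟨ +ₚ-Props.interchange p q _ _ ⟩
  (p +ₚ (false ∷ deriv p)) +ₚ (q +ₚ (false ∷ deriv q))   ∎
  where open ≐-Reasoning

deriv-≐[] : ∀ {p} → p ≐ [] → deriv p ≐ []
deriv-≐[] {[]} e = ≐-refl
deriv-≐[] {c ∷ p} e = begin
  p +ₚ (false ∷ deriv p)  ≈⟨ +ₚ-cong (∷≐[]⇒≐[] e) (∷-cong false (deriv-≐[] (∷≐[]⇒≐[] e))) ⟩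
  [] +ₚ (false ∷ [])      ≈⟨ []≐false∷[] ⟨
  []                      ∎
  where open ≐-Reasoning

deriv-cong : ∀ {p q} → p ≐ q → deriv p ≐ deriv q
deriv-cong {p} {q} e = +ₚ≐[]⇒≐ (begin
  deriv p +ₚ deriv q  ≈⟨ deriv-+ₚ p q ⟨
  deriv (p +ₚ q)      ≈⟨ deriv-≐[] (≐-trans (+ₚ-congʳ q e) (+ₚ-self q)) ⟩
  []                  ∎)
  where open ≐-Reasoning

deriv-scale : ∀ c q → deriv (scale c q) ≡ scale c (deriv q)
deriv-scale true q = refl
deriv-scale false q = refl

deriv-*ₚ : ∀ p q → deriv (p *ₚ q) ≐ deriv p *ₚ q +ₚ p *ₚ deriv q
deriv-*ₚ [] q = ≐-refl
deriv-*ₚ (c ∷ p) q = begin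
  deriv (scale c q +ₚ (false ∷ p *ₚ q))
    ≈⟨ deriv-+ₚ (scale c q) (false ∷ p *ₚ q) ⟩
  deriv (scale c q) +ₚ (p *ₚ q +ₚ (false ∷ deriv (p *ₚ q)))
    ≈⟨ +ₚ-cong (≐-reflexive (deriv-scale c q)) (+ₚ-congˡ (p *ₚ q) (∷-cong false (deriv-*ₚ p q))) ⟩
  scale c (deriv q) +ₚ (p *ₚ q +ₚ ((false ∷ deriv p *ₚ q) +ₚ (false ∷ p *ₚ deriv q)))
    ≈⟨ +ₚ-congˡ (scale c (deriv q)) (≐-reflexive (sym (+ₚ-assoc (p *ₚ q) (false ∷ deriv p *ₚ q) _))) ⟩
  scale c (deriv q) +ₚ ((p *ₚ q +ₚ (false ∷ deriv p *ₚ q)) +ₚ (false ∷ p *ₚ deriv q))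
    ≈⟨ +ₚ-Props.x∙yz≈y∙xz (scale c (deriv q)) (p *ₚ q +ₚ (false ∷ deriv p *ₚ q)) _ ⟩
  (p *ₚ q +ₚ (false ∷ deriv p *ₚ q)) +ₚ (scale c (deriv q) +ₚ (false ∷ p *ₚ deriv q))
    ≈⟨ +ₚ-congʳ (scale c (deriv q) +ₚ (false ∷ p *ₚ deriv q)) (*ₚ-distribʳ p (false ∷ deriv p) q) ⟨
  (p +ₚ (false ∷ deriv p)) *ₚ q +ₚ (scale c (deriv q) +ₚ (false ∷ p *ₚ deriv q))
    ∎
  where open ≐-Reasoning

deriv-oneₚ : deriv oneₚ ≐ []
deriv-oneₚ = ≐-sym []≐false∷[]

deriv-square : ∀ p → deriv (p *ₚ p) ≐ []
deriv-square p = begin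
  deriv (p *ₚ p)                    ≈⟨ deriv-*ₚ p p ⟩
  deriv p *ₚ p +ₚ p *ₚ deriv p      ≈⟨ +ₚ-cong (*ₚ-comm (deriv p) p) ≐-refl ⟩
  p *ₚ deriv p +ₚ p *ₚ deriv p      ≈⟨ +ₚ-self (p *ₚ deriv p) ⟩
  []                                ∎
  where open ≐-Reasoning

geometric-*ₚ-+1 : ∀ m n → geometric m n *ₚ (m +ₚ oneₚ) ≐ m ^ₚ suc n +ₚ oneₚ
geometric-*ₚ-+1 m zero = ≐-trans (*ₚ-identityˡ (m +ₚ oneₚ)) (+ₚ-congʳ oneₚ (≐-sym (*ₚ-identityʳ m)))
geometric-*ₚ-+1 m (suc n) = begin
  (oneₚ +ₚ m *ₚ G) *ₚ (m +ₚ oneₚ)              ≈⟨ *ₚ-distribʳ oneₚ (m *ₚ G) (m +ₚ oneₚ) ⟩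
  oneₚ *ₚ (m +ₚ oneₚ) +ₚ (m *ₚ G) *ₚ (m +ₚ oneₚ) ≈⟨ +ₚ-cong (*ₚ-identityˡ _) (*ₚ-assoc m G _) ⟩
  (m +ₚ oneₚ) +ₚ m *ₚ (G *ₚ (m +ₚ oneₚ))       ≈⟨ +ₚ-congˡ (m +ₚ oneₚ) (*ₚ-congˡ m (geometric-*ₚ-+1 m n)) ⟩
  (m +ₚ oneₚ) +ₚ m *ₚ (m ^ₚ suc n +ₚ oneₚ)     ≈⟨ +ₚ-congˡ (m +ₚ oneₚ) (*ₚ-distribˡ m (m ^ₚ suc n) oneₚ) ⟩
  (m +ₚ oneₚ) +ₚ (m ^ₚ suc (suc n) +ₚ m *ₚ oneₚ) ≈⟨ +ₚ-congˡ (m +ₚ oneₚ) (+ₚ-congˡ _ (*ₚ-identityʳ m)) ⟩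
  (m +ₚ oneₚ) +ₚ (m ^ₚ suc (suc n) +ₚ m)       ≡⟨ cong₂ _+ₚ_ (+ₚ-comm m oneₚ) (+ₚ-comm _ m) ⟩
  (oneₚ +ₚ m) +ₚ (m +ₚ m ^ₚ suc (suc n))       ≈⟨ +ₚ-cancel-middle oneₚ m _ ⟩
  oneₚ +ₚ m ^ₚ suc (suc n)                     ≡⟨ +ₚ-comm oneₚ _ ⟩
  m ^ₚ suc (suc n) +ₚ oneₚ                     ∎
  where
  open ≐-Reasoning
  G = geometric m n

square∣⇒∣deriv : ∀ f p → f *ₚ f ∣ p → f ∣ deriv p
square∣⇒∣deriv f p (q , qff≐p) = deriv q *ₚ f , (begin
  (deriv q *ₚ f) *ₚ f                           ≈⟨ *ₚ-assoc (deriv q) f f ⟩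
  deriv q *ₚ (f *ₚ f)                           ≡⟨ +ₚ-identityʳ _ ⟨
  deriv q *ₚ (f *ₚ f) +ₚ []                     ≈⟨ +ₚ-congˡ _ (≐-trans (*ₚ-congˡ q (deriv-square f)) (*ₚ-zeroʳ q)) ⟨
  deriv q *ₚ (f *ₚ f) +ₚ q *ₚ deriv (f *ₚ f)    ≈⟨ deriv-*ₚ q (f *ₚ f) ⟨
  deriv (q *ₚ (f *ₚ f))                         ≈⟨ deriv-cong qff≐p ⟩
  deriv p                                       ∎)
  where open ≐-Reasoning

deriv-^ₚ-even : ∀ m k → deriv (m ^ₚ (2 * k)) ≐ []
deriv-^ₚ-even m k = ≐-trans (deriv-cong m²ᵏ≐mᵏmᵏ) (deriv-square (m ^ₚ k))
  where
  m²ᵏ≐mᵏmᵏ : m ^ₚ (2 * k) ≐ m ^ₚ k *ₚ m ^ₚ k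
  m²ᵏ≐mᵏmᵏ = ≐-sym (≐-trans (^ₚ-+ m k k) (≐-reflexive (cong (λ j → m ^ₚ (k + j)) (sym (+-identityʳ k)))))

deriv-geometric-*ₚ-+1 : ∀ m k → deriv (geometric m (2 * k) *ₚ (m +ₚ oneₚ)) ≐ m ^ₚ (2 * k) *ₚ deriv m
deriv-geometric-*ₚ-+1 m k = begin
  deriv (geometric m (2 * k) *ₚ (m +ₚ oneₚ))   ≈⟨ deriv-cong (geometric-*ₚ-+1 m (2 * k)) ⟩
  deriv (m *ₚ m²ᵏ +ₚ oneₚ)                     ≈⟨ deriv-+ₚ (m *ₚ m²ᵏ) oneₚ ⟩
  deriv (m *ₚ m²ᵏ) +ₚ deriv oneₚ               ≈⟨ +ₚ-congˡ _ deriv-oneₚ ⟩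
  deriv (m *ₚ m²ᵏ) +ₚ []                       ≡⟨ +ₚ-identityʳ _ ⟩
  deriv (m *ₚ m²ᵏ)                             ≈⟨ deriv-*ₚ m m²ᵏ ⟩
  deriv m *ₚ m²ᵏ +ₚ m *ₚ deriv m²ᵏ             ≈⟨ +ₚ-congˡ _ (≐-trans (*ₚ-congˡ m (deriv-^ₚ-even m k)) (*ₚ-zeroʳ m)) ⟩
  deriv m *ₚ m²ᵏ +ₚ []                         ≡⟨ +ₚ-identityʳ _ ⟩
  deriv m *ₚ m²ᵏ                               ≈⟨ *ₚ-comm (deriv m) m²ᵏ ⟩
  m²ᵏ *ₚ deriv m                               ∎
  where
  open ≐-Reasoning
  m²ᵏ = m ^ₚ (2 * k)

-- A repeated factor f of A = σ(m²ᵏ) divides A and A′, hence (A·(m+1))′ = m²ᵏ·m′,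
-- and then also m′ = m·(m²ᵏ·m′) + A·(m+1)·m′.
square∣geometric⇒∣deriv : ∀ m k f → f *ₚ f ∣ geometric m (2 * k) → f ∣ deriv m
square∣geometric⇒∣deriv m k f ff∣A = ∣ʳ-respʳ-≈ m′≐ (∣-+ₚ (x∣ʳy⇒x∣ʳzy m f∣P) (∣-*ₚʳ m′ f∣A·m+1))
  where
  open ≐-Reasoning
  A = geometric m (2 * k)
  m′ = deriv m
  m²ᵏ = m ^ₚ (2 * k)
  P = m²ᵏ *ₚ m′

  f∣A : f ∣ A
  f∣A = ∣ʳ-trans (x∣xy f f) ff∣A

  f∣A·m+1 : f ∣ A *ₚ (m +ₚ oneₚ)
  f∣A·m+1 = ∣-*ₚʳ (m +ₚ oneₚ) f∣A

  f∣P : f ∣ P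
  f∣P = ∣ʳ-respʳ-≈ (≐-trans (≐-sym (deriv-*ₚ A (m +ₚ oneₚ))) (deriv-geometric-*ₚ-+1 m k))
          (∣-+ₚ (∣-*ₚʳ (m +ₚ oneₚ) (square∣⇒∣deriv f A ff∣A)) (∣-*ₚʳ (deriv (m +ₚ oneₚ)) f∣A))

  m′≐ : m *ₚ P +ₚ (A *ₚ (m +ₚ oneₚ)) *ₚ m′ ≐ m′
  m′≐ = begin
    m *ₚ P +ₚ (A *ₚ (m +ₚ oneₚ)) *ₚ m′         ≈⟨ +ₚ-congˡ _ (*ₚ-congʳ m′ (geometric-*ₚ-+1 m (2 * k))) ⟩
    m *ₚ P +ₚ (m *ₚ m²ᵏ +ₚ oneₚ) *ₚ m′         ≈⟨ +ₚ-congˡ _ (*ₚ-distribʳ (m *ₚ m²ᵏ) oneₚ m′) ⟩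
    m *ₚ P +ₚ ((m *ₚ m²ᵏ) *ₚ m′ +ₚ oneₚ *ₚ m′) ≈⟨ +ₚ-congˡ (m *ₚ P) (+ₚ-cong (*ₚ-assoc m m²ᵏ m′) (*ₚ-identityˡ m′)) ⟩
    m *ₚ P +ₚ (m *ₚ P +ₚ m′)                   ≈⟨ +ₚ-self-cancelˡ (m *ₚ P) m′ ⟩
    m′                                         ∎

-- Degree counting over 𝓕

_≟ₗ_ : (p q : Poly) → Dec (p ≡ q)
_≟ₗ_ = ≡-dec _≟ᵇ_

module ℕ+-Props = CommSemigroupProps +-commutativeSemigroup

degree : Poly → ℕ
degree p = pred (size p)

degreeSum : List Poly → ℕ
degreeSum fs = sum (map degree fs)

size-prod : ∀ fs → All (λ f → 1 ≤ size f) fs → size (prod fs) ≡ suc (degreeSum fs)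
size-prod [] [] = refl
size-prod (f ∷ fs) (1≤sf ∷ ps) with size f in sf
... | suc a = size-*ₚ f (prod fs) sf (size-prod fs ps)

∈⇒∣prod : ∀ {x xs} → x ∈ xs → x ∣ prod xs
∈⇒∣prod {x} {_ ∷ xs} (here refl) = x∣xy x (prod xs)
∈⇒∣prod {x} {y ∷ xs} (there x∈) = x∣ʳy⇒x∣ʳzy y (∈⇒∣prod x∈)

unique-or-repeated : ∀ xs → Unique xs ⊎ ∃ λ f → f ∈ xs × f *ₚ f ∣ prod xs
unique-or-repeated [] = inj₁ AllPairs.[]
unique-or-repeated (x ∷ xs) with x ∈? xs
... | yes x∈xs = inj₂ (x , here refl , x∣y⇒zx∣zy x (∈⇒∣prod x∈xs))
... | no x∉xs with unique-or-repeated xs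
...   | inj₁ u = inj₁ (All.tabulate (λ y∈xs x≡y → x∉xs (subst (_∈ xs) (sym x≡y) y∈xs)) AllPairs.∷ u)
...   | inj₂ (f , f∈xs , ff∣prod) = inj₂ (f , there f∈xs , x∣ʳy⇒x∣ʳzy x ff∣prod)

degreeSum-++ : ∀ xs ys → degreeSum (xs ++ ys) ≡ degreeSum xs + degreeSum ys
degreeSum-++ [] ys = refl
degreeSum-++ (x ∷ xs) ys = trans (cong (degree x +_) (degreeSum-++ xs ys)) (sym (+-assoc (degree x) _ _))

degreeSum-⊆ : ∀ xs zs → Unique xs → (∀ {x} → x ∈ xs → x ∈ zs) → degreeSum xs ≤ degreeSum zs
degreeSum-⊆ [] zs _ _ = z≤n
degreeSum-⊆ (x ∷ xs) zs (x∉xs AllPairs.∷ u) xs⊆zs with ∈-∃++ (xs⊆zs (here refl))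
... | as , bs , refl = begin
  degree x + degreeSum xs                  ≤⟨ +-monoʳ-≤ (degree x) (degreeSum-⊆ xs (as ++ bs) u xs⊆as++bs) ⟩
  degree x + degreeSum (as ++ bs)          ≡⟨ cong (degree x +_) (degreeSum-++ as bs) ⟩
  degree x + (degreeSum as + degreeSum bs) ≡⟨ ℕ+-Props.x∙yz≈y∙xz (degree x) (degreeSum as) _ ⟩
  degreeSum as + (degree x + degreeSum bs) ≡⟨ degreeSum-++ as (x ∷ bs) ⟨
  degreeSum (as ++ x ∷ bs)                 ∎
  where
  open ≤-Reasoning
  xs⊆as++bs : ∀ {y} → y ∈ xs → y ∈ as ++ bs
  xs⊆as++bs {y} y∈xs with ∈-++⁻ as (xs⊆zs (there y∈xs))
  ... | inj₁ y∈as = ∈-++⁺ˡ y∈as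
  ... | inj₂ (here refl) = ⊥-elim (All.lookup x∉xs y∈xs refl)
  ... | inj₂ (there y∈bs) = ∈-++⁺ʳ as y∈bs

degreeSum-filter-≤ : ∀ {P : Poly → Set} (P? : Decidable P) xs → degreeSum (filter P? xs) ≤ degreeSum xs
degreeSum-filter-≤ P? [] = z≤n
degreeSum-filter-≤ P? (x ∷ xs) with P? x
... | yes _ = +-monoʳ-≤ (degree x) (degreeSum-filter-≤ P? xs)
... | no _ = ≤-trans (degreeSum-filter-≤ P? xs) (m≤n+m _ (degree x))

size-+ₚ-oneₚ : ∀ p {k} → size p ≡ suc (suc k) → size (p +ₚ oneₚ) ≡ suc (suc k)
size-+ₚ-oneₚ p sp = trans (cong size (+ₚ-comm p oneₚ)) (size-+ₚ-dominant oneₚ p (s≤s z≤n) sp)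

size-geometric : ∀ m {d} n → size m ≡ suc (suc d) → size (geometric m n) ≡ suc (n * suc d)
size-geometric m {d} n sm with size (geometric m n) in sG
... | zero with () ← trans (sym (size-+ₚ-oneₚ (m ^ₚ suc n) (size-^ₚ m (suc n) sm)))
                      (trans (sym (size-cong (geometric-*ₚ-+1 m n)))
                        (size-cong (*ₚ-zeroˡ (m +ₚ oneₚ) (size≡0⇒≐[] (geometric m n) sG))))
... | suc a = cong suc (+-cancelˡ-≡ (suc d) a (n * suc d) (begin
  suc d + a                                   ≡⟨ +-comm (suc d) a ⟩
  a + suc d                                   ≡⟨ cong pred (size-*ₚ (geometric m n) (m +ₚ oneₚ) sG (size-+ₚ-oneₚ m sm)) ⟨
  pred (size (geometric m n *ₚ (m +ₚ oneₚ)))  ≡⟨ cong pred (size-cong (geometric-*ₚ-+1 m n)) ⟩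
  pred (size (m ^ₚ suc n +ₚ oneₚ))            ≡⟨ cong pred (size-+ₚ-oneₚ (m ^ₚ suc n) (size-^ₚ m (suc n) sm)) ⟩
  suc n * suc d                               ∎))
  where open ≡-Reasoning

opaque
  𝓕-monic : All MonicRep 𝓕
  𝓕-monic = All.map ≈⇒≐ (toWitness {a? = All.all? (λ f → norm (Monic.g (lowCoeffs f)) ≟ₗ norm f) 𝓕} _)

∈𝓕⇒size≥1 : ∀ {f} → f ∈ 𝓕 → 1 ≤ size f
∈𝓕⇒size≥1 {f} f∈𝓕 rewrite sym (size-cong (All.lookup 𝓕-monic f∈𝓕)) | Monic.size-g (lowCoeffs f) = s≤s z≤n

dividingMembers : Poly → List Poly
dividingMembers p = filter (_∣ᵣ? p) 𝓕

factorization-degree-bound : ∀ m {d} → size m ≡ suc (suc d) → (∀ {f} → f ∈ 𝓕 → ¬ f ∣ deriv m) →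
  ∀ h fs → All (_∈ 𝓕) fs → prod fs ≐ geometric m (2 * h) →
  2 * h * suc d ≤ degreeSum (dividingMembers (geometric m (2 * h)))
factorization-degree-bound m {d} sm ¬f∣m′ h fs fs⊆𝓕 prod≐G with unique-or-repeated fs
... | inj₂ (f , f∈fs , ff∣prod) =
  ⊥-elim (¬f∣m′ (All.lookup fs⊆𝓕 f∈fs) (square∣geometric⇒∣deriv m h f (∣ʳ-respʳ-≈ prod≐G ff∣prod)))
... | inj₁ unique = begin
  2 * h * suc d                                       ≡⟨ cong pred size-G ⟨
  pred (size (geometric m (2 * h)))                   ≡⟨ cong pred (size-cong prod≐G) ⟨
  pred (size (prod fs))                               ≡⟨ cong pred (size-prod fs (All.map ∈𝓕⇒size≥1 fs⊆𝓕)) ⟩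
  degreeSum fs                                        ≤⟨ degreeSum-⊆ fs _ unique fs⊆dividing ⟩
  degreeSum (dividingMembers (geometric m (2 * h)))   ∎
  where
  open ≤-Reasoning
  size-G : size (geometric m (2 * h)) ≡ suc (2 * h * suc d)
  size-G = size-geometric m (2 * h) sm
  fs⊆dividing : ∀ {x} → x ∈ fs → x ∈ dividingMembers (geometric m (2 * h))
  fs⊆dividing x∈fs = ∈-filter⁺ (_∣ᵣ? geometric m (2 * h)) x∈𝓕
    (∣⇒∣ᵣ (All.lookup 𝓕-monic x∈𝓕) (∣ʳ-respʳ-≈ prod≐G (∈⇒∣prod x∈fs)))
    where x∈𝓕 = All.lookup fs⊆𝓕 x∈fs

-- Even powers of M₁, …, M₁₃

Deficient : Poly → ℕ → ℕ → Set
Deficient m d h = degreeSum (dividingMembers (geometric m (2 * h))) < 2 * h * suc d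

factorsIn𝓕⇒degree-bound : ∀ m {d} → size m ≡ suc (suc d) → Prime m → (∀ {f} → f ∈ 𝓕 → ¬ f ∣ deriv m) →
  ∀ h → FactorsIn𝓕 (σ (m ^ₚ (2 * h))) → 2 * h * suc d ≤ degreeSum (dividingMembers (geometric m (2 * h)))
factorsIn𝓕⇒degree-bound m sm prime ¬f∣m′ h (fs , fs⊆𝓕 , prod≈σ) =
  factorization-degree-bound m sm ¬f∣m′ h fs fs⊆𝓕 (≐-trans (≈⇒≐ prod≈σ) (σ-prime-power prime sm (2 * h)))

-- Beyond H the degree 2h·(d + 1) of σ(m²ʰ) exceeds the total degree of 𝓕, so only h ≤ H need checking.
even-power-classification : ∀ m {d} (P : ℕ → Set) → size m ≡ suc (suc d) → Prime m →
  (∀ {f} → f ∈ 𝓕 → ¬ f ∣ deriv m) →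
  ∀ H → degreeSum 𝓕 < 2 * suc H * suc d →
  (∀ {n} → n < H → P (suc n) ⊎ Deficient m d (suc n)) →
  ∀ h → 1 ≤ h → FactorsIn𝓕 (σ (m ^ₚ (2 * h))) → P h
even-power-classification m {d} P sm prime ¬f∣m′ H big checked (suc n) _ factors
  with n <? H | factorsIn𝓕⇒degree-bound m sm prime ¬f∣m′ (suc n) factors
... | yes n<H | bound = [ id , (λ deficient → ⊥-elim (<⇒≱ deficient bound)) ]′ (checked n<H)
... | no n≮H | bound = ⊥-elim (<⇒≱ big (begin
  2 * suc H * suc d                                       ≤⟨ *-monoˡ-≤ (suc d) (*-monoʳ-≤ 2 (s≤s (≮⇒≥ n≮H))) ⟩
  2 * suc n * suc d                                       ≤⟨ bound ⟩
  degreeSum (dividingMembers (geometric m (2 * suc n)))   ≤⟨ degreeSum-filter-≤ (_∣ᵣ? geometric m (2 * suc n)) 𝓕 ⟩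
  degreeSum 𝓕                                             ∎))
  where open ≤-Reasoning

Conclusion : Fin 13 → ℕ → Set
Conclusion i h = (M i ≡ M₁ × (2 * h ≡ 2 ⊎ 2 * h ≡ 4 ⊎ 2 * h ≡ 6 ⊎ 2 * h ≡ 14))
               ⊎ ((M i ≡ M₂ ⊎ M i ≡ M₃) × 2 * h ≡ 2)

conclusion? : ∀ i h → Dec (Conclusion i h)
conclusion? i h =
  ((M i ≟ₗ M₁) ×-dec ((2 * h ≟ 2) ⊎-dec (2 * h ≟ 4) ⊎-dec (2 * h ≟ 6) ⊎-dec (2 * h ≟ 14)))
  ⊎-dec (((M i ≟ₗ M₂) ⊎-dec (M i ≟ₗ M₃)) ×-dec (2 * h ≟ 2))

δ hMax : Fin 13 → ℕ
δ i = size (M i) ∸ 2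
hMax i = degreeSum 𝓕 / (2 * suc (δ i))

Certified : Fin 13 → Set
Certified i = size (M i) ≡ suc (suc (δ i))
            × M i ∈ 𝓕
            × (∀ v → Monic.HasFermatInverse (lowCoeffs (M i)) v)
            × All (λ f → ¬ f ∣ᵣ deriv (M i)) 𝓕
            × degreeSum 𝓕 < 2 * suc (hMax i) * suc (δ i)
            × (∀ {n} → n < hMax i → Conclusion i (suc n) ⊎ Deficient (M i) (δ i) (suc n))

certified? : ∀ i → Dec (Certified i)
certified? i = (size (M i) ≟ suc (suc (δ i)))
         ×-dec (M i ∈? 𝓕)
         ×-dec Monic.allHaveFermatInverse? (lowCoeffs (M i))
         ×-dec All.all? (λ f → ¬? (f ∣ᵣ? deriv (M i))) 𝓕
         ×-dec (degreeSum 𝓕 <? 2 * suc (hMax i) * suc (δ i))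
         ×-dec allUpTo? (λ n → conclusion? i (suc n) ⊎-dec deficient? (suc n)) (hMax i)
  where
  deficient? : ∀ h → Dec (Deficient (M i) (δ i) h)
  deficient? h = degreeSum (dividingMembers (geometric (M i) (2 * h))) <? 2 * h * suc (δ i)

-- Opaque, so that the type checker never re-runs this evaluation when certified i is used.
opaque
  certified : ∀ i → Certified i
  certified = toWitness {a? = Fin.all? certified?} _

prime-M : ∀ i → Prime (M i)
prime-M i with certified i
... | _ , M∈𝓕 , fermat , _ = Prime-resp-≐ (All.lookup 𝓕-monic M∈𝓕)
  (Monic.invertible⇒prime (lowCoeffs (M i)) (Monic.fermat-invertible (lowCoeffs (M i)) fermat))

classify : ∀ i h → 1 ≤ h → FactorsIn𝓕 (σ (M i ^ₚ (2 * h))) → Conclusion i h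
classify i with certified i
... | sM , _ , _ , no-derivative-factor , big , checked =
  even-power-classification (M i) (Conclusion i) sM (prime-M i) ¬f∣M′ (hMax i) big checked
  where
  ¬f∣M′ : ∀ {f} → f ∈ 𝓕 → ¬ f ∣ deriv (M i)
  ¬f∣M′ f∈𝓕 f∣M′ = All.lookup no-derivative-factor f∈𝓕 (∣⇒∣ᵣ (All.lookup 𝓕-monic f∈𝓕) f∣M′)

-- m is given explicitly so that the type checker never has to unfold σ (m ^ₚ n).
σ-M-power : ∀ i m → M i ≡ m → ∀ n T → True (norm (geometric m n) ≟ₗ norm T) → σ (m ^ₚ n) ≈ T
σ-M-power i m refl n T check with certified i
... | sM , _ = ≐⇒≈ (≐-trans (σ-prime-power (prime-M i) sM n) (≈⇒≐ {geometric m n} {T} (toWitness check)))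

lemma2p15 : ((i : Fin 13) (h : ℕ) → 1 ≤ h → FactorsIn𝓕 (σ (M i ^ₚ (2 * h))) →
    (M i ≡ M₁ × (2 * h ≡ 2 ⊎ 2 * h ≡ 4 ⊎ 2 * h ≡ 6 ⊎ 2 * h ≡ 14))
    ⊎ ((M i ≡ M₂ ⊎ M i ≡ M₃) × 2 * h ≡ 2))
    × σ (M₂ ^ₚ 2) ≈ M₁ *ₚ M₅
    × σ (M₃ ^ₚ 2) ≈ M₁ *ₚ M₄
    × σ (M₁ ^ₚ 2) ≈ S₁
    × σ (M₁ ^ₚ 4) ≈ S₈
    × σ (M₁ ^ₚ 6) ≈ M₂ *ₚ M₃ *ₚ S₂
    × σ (M₁ ^ₚ 14) ≈ M₄ *ₚ M₅ *ₚ S₁ *ₚ S₇ *ₚ S₈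
lemma2p15 = classify
          , σ-M-power (suc zero) M₂ refl 2 (M₁ *ₚ M₅) _
          , σ-M-power (suc (suc zero)) M₃ refl 2 (M₁ *ₚ M₄) _
          , σ-M-power zero M₁ refl 2 S₁ _
          , σ-M-power zero M₁ refl 4 S₈ _
          , σ-M-power zero M₁ refl 6 (M₂ *ₚ M₃ *ₚ S₂) _
          , σ-M-power zero M₁ refl 14 (M₄ *ₚ M₅ *ₚ S₁ *ₚ S₇ *ₚ S₈) _
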